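{- Let $n$ and $a_1,\ldots,a_m$ be positive integers and let $S=S(a_1,\ldots,a_m)=\{\sum_{i=1}^m x_ia_i : x_1,\ldots,x_m\in\{0,1,2,\ldots\}\}$. Then the following two sets have the same cardinality: (i) the set of partitions of $n$ in which each part lies in $S$ and each difference $\lambda-\mu\ge 0$ between two parts $\lambda,\mu$ lies in $S$; (ii) the set of partitions of $n$ in which each part appears with multiplicity lying in $S$. Moreover, suppose $a_1,\ldots,a_m$ satisfy the condition (*) for every $i=2,\ldots,m$ there exists $j<i$ such that $\operatorname{lcm}(\gcd(a_1,\ldots,a_{i-1}),a_i)=\operatorname{lcm}(a_j,a_i)$. Then the sets in (i) and (ii) also have the same cardinality as (iii) the set of partitions of $n$ in which each part is divisible by some $a_i$, $1\le i\le m$.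
   Context: A partition of $n$ is an unordered multiset of positive integers (parts) whose sum is $n$. The multiplicity of a part is the number of times it occurs in the multiset. $\gcd$ and $\operatorname{lcm}$ denote greatest common divisor and least common multiple. -}

module Defs where

open import Data.Nat using (ℕ; zero; suc; _+_; _*_; _∸_; _<_; _≤_; _≥_)
open import Data.Nat.Divisibility using (_∣_)
open import Data.Nat.GCD using (gcd)
open import Data.Nat.LCM using (lcm)
open import Data.Fin using (Fin; toℕ)
import Data.Fin as F
open import Data.List using (List; length; filter)
open import Data.Nat.ListAction using (sum)
open import Data.List.Membership.Propositional using (_∈_)
open import Data.List.Relation.Unary.All using (All)
open import Data.List.Relation.Unary.Linked using (Linked)
open import Data.Product using (Σ; ∃; _×_; proj₁)
open import Relation.Binary.Bundles using (Setoid)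
open import Relation.Binary.PropositionalEquality using (_≡_; setoid)
import Relation.Binary.Construct.On as On
open import Function.Bundles using (Bijection)
open import Data.Nat using (_≟_)
open import Level using (0ℓ)

lincomb : ∀ {m} → (Fin m → ℕ) → (Fin m → ℕ) → ℕ
lincomb {zero}  x a = 0
lincomb {suc m} x a = x F.zero * a F.zero + lincomb (λ i → x (F.suc i)) (λ i → a (F.suc i))

InS : ∀ {m} → (Fin m → ℕ) → ℕ → Set
InS {m} a v = ∃ λ (x : Fin m → ℕ) → lincomb x a ≡ v

-- a partition of n, represented canonically as a non-increasing list of positive parts
IsPartition : ℕ → List ℕ → Set
IsPartition n l = Linked _≥_ l × All (λ p → 0 < p) l × sum l ≡ n

mult : ℕ → List ℕ → ℕ
mult p l = length (filter (_≟ p) l)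

CondI : ∀ {m} → (Fin m → ℕ) → List ℕ → Set
CondI a l = (∀ p → p ∈ l → InS a p)
          × (∀ λ' μ → λ' ∈ l → μ ∈ l → μ ≤ λ' → InS a (λ' ∸ μ))

CondII : ∀ {m} → (Fin m → ℕ) → List ℕ → Set
CondII a l = ∀ p → p ∈ l → InS a (mult p l)

CondIII : ∀ {m} → (Fin m → ℕ) → List ℕ → Set
CondIII a l = ∀ p → p ∈ l → ∃ λ i → a i ∣ p

-- the set of partitions of n satisfying P, as a setoid where two elements are
-- equal iff their underlying (canonical) lists are equal
Parts : ℕ → (List ℕ → Set) → Setoid 0ℓ 0ℓ
Parts n P = On.setoid (setoid (List ℕ)) (proj₁ {B = λ l → IsPartition n l × P l})

SameCard : Setoid 0ℓ 0ℓ → Setoid 0ℓ 0ℓ → Set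
SameCard A B = Bijection A B

-- gcdFirst a k = gcd(a_1,…,a_k)  (gcd of empty family = 0)
gcdFirst : ∀ {m} → (Fin m → ℕ) → ℕ → ℕ
gcdFirst {zero}  a k       = 0
gcdFirst {suc m} a zero    = 0
gcdFirst {suc m} a (suc k) = gcd (a F.zero) (gcdFirst (λ i → a (F.suc i)) k)

-- condition (*), with 0-based indices: for every index i ≥ 1 there is j < i with
-- lcm(gcd(a_0,…,a_{i-1}), a_i) = lcm(a_j, a_i)
CondStar : ∀ {m} → (Fin m → ℕ) → Set
CondStar {m} a = ∀ (i : Fin m) → 1 ≤ toℕ i →
  ∃ λ (j : Fin m) → toℕ j < toℕ i × lcm (gcdFirst a (toℕ i)) (a i) ≡ lcm (a j) (a i)

module Submission where

-- For positive a_1, …, a_m, the partitions of n of the three kinds (i), (ii)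
-- and (iii) are related by explicit bijections.
--  * (i) ↔ (ii) is conjugation (module Conjugation): the multiplicities of the
--    conjugate are the differences of consecutive parts, and conversely the
--    parts are sums of consecutive multiplicities; S(a) is closed under +.
--  * Under (*), (ii) ↔ (iii) factors through valid families of blocks (module
--    Blocks).  On the side of (ii) this rests on the existence and uniqueness
--    of bounded representations in S(a), where (*) enters (module
--    BoundedRepresentations); on the side of (iii) it is Glaisher's
--    construction, using base-D_i expansions (module Radix).

open import Defs
open import Data.Nat using (ℕ; _<_)
open import Data.Fin using (Fin)
open import Data.Product using (_×_; _,_)
open import Relation.Binary.Definitions using (DecidableEquality)
import Function.Construct.Composition as Composition

module Sums where

  open import Data.Nat using (ℕ; _+_)
  open import Data.Nat.Tactic.RingSolver using (solve-∀)
  open import Data.List using (List; []; _∷_)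
  open import Data.List.Membership.Propositional using (_∈_)
  open import Data.List.Relation.Unary.Any using (here; there)
  open import Relation.Binary.PropositionalEquality

  Σl : {A : Set} → (A → ℕ) → List A → ℕ
  Σl h []      = 0
  Σl h (x ∷ l) = h x + Σl h l

  Σl-cong : ∀ {A : Set} {h g : A → ℕ} (l : List A) → (∀ x → x ∈ l → h x ≡ g x) → Σl h l ≡ Σl g l
  Σl-cong []      e = refl
  Σl-cong (x ∷ l) e = cong₂ _+_ (e x (here refl)) (Σl-cong l (λ y y∈l → e y (there y∈l)))

  Σl-+ : ∀ {A : Set} (h g : A → ℕ) l → Σl (λ x → h x + g x) l ≡ Σl h l + Σl g l
  Σl-+ h g []      = refl
  Σl-+ h g (x ∷ l) rewrite Σl-+ h g l = regroup (h x) (g x) (Σl h l) (Σl g l)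
    where
    regroup : ∀ u v U V → u + v + (U + V) ≡ u + U + (v + V)
    regroup = solve-∀

module Multiset {A : Set} (_≟_ : DecidableEquality A) where

  open import Data.Nat using (ℕ; zero; suc; _+_; _*_; _<_; z≤n; s≤s)
  open import Data.Nat.Properties using (+-assoc; +-comm; suc-injective; 0≢1+n; *-zeroʳ; *-suc)
  open import Data.List using (List; []; _∷_; [_]; _++_; length; filter; replicate; concatMap)
  open import Data.List.Properties using (filter-accept; filter-reject; filter-++; filter-some; filter-none; length-++)
  open import Data.List.Membership.Propositional using (_∈_; _∉_)
  open import Data.List.Relation.Unary.Any using (here; there)
  import Data.List.Relation.Unary.Any as Any
  open import Data.List.Relation.Unary.All.Properties using (¬Any⇒All¬)
  import Data.List.Relation.Unary.All as All
  open import Data.List.Relation.Unary.AllPairs using (_∷_)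
  open import Data.List.Relation.Unary.Unique.Propositional using (Unique)
  open import Relation.Binary.PropositionalEquality hiding ([_])
  open import Relation.Nullary using (Dec; yes; no)
  open import Data.Empty using (⊥-elim)
  open Sums

  -- multiplicity of p in l (for A = ℕ this is exactly Defs.mult)
  count : A → List A → ℕ
  count p l = length (filter (_≟ p) l)

  count-here : ∀ p l → count p (p ∷ l) ≡ suc (count p l)
  count-here p l = cong length (filter-accept (_≟ p) refl)

  count-there : ∀ {x p} l → x ≢ p → count p (x ∷ l) ≡ count p l
  count-there {p = p} l x≢p = cong length (filter-reject (_≟ p) x≢p)

  count-++ : ∀ p l₁ l₂ → count p (l₁ ++ l₂) ≡ count p l₁ + count p l₂
  count-++ p l₁ l₂ = trans (cong length (filter-++ (_≟ p) l₁ l₂)) (length-++ (filter (_≟ p) l₁))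

  δ : A → A → ℕ
  δ x p = count p [ x ]

  δ-same : ∀ p → δ p p ≡ 1
  δ-same p = count-here p []

  δ-other : ∀ {x p} → x ≢ p → δ x p ≡ 0
  δ-other = count-there []

  count-∷ : ∀ x p l → count p (x ∷ l) ≡ δ x p + count p l
  count-∷ x p l = count-++ p [ x ] l

  Σl-δ : ∀ p l → Σl (λ x → δ x p) l ≡ count p l
  Σl-δ p []      = refl
  Σl-δ p (x ∷ l) = trans (cong (δ x p +_) (Σl-δ p l)) (sym (count-∷ x p l))

  count-replicate-same : ∀ p k → count p (replicate k p) ≡ k
  count-replicate-same p zero    = refl
  count-replicate-same p (suc k) = trans (count-here p _) (cong suc (count-replicate-same p k))

  count-replicate-other : ∀ {x p} k → x ≢ p → count p (replicate k x) ≡ 0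
  count-replicate-other zero    x≢p = refl
  count-replicate-other (suc k) x≢p = trans (count-there _ x≢p) (count-replicate-other k x≢p)

  count-concatMap : ∀ {X : Set} (φ : X → List A) p xs →
    count p (concatMap φ xs) ≡ Σl (λ x → count p (φ x)) xs
  count-concatMap φ p []       = refl
  count-concatMap φ p (x ∷ xs) =
    trans (count-++ p (φ x) (concatMap φ xs)) (cong (count p (φ x) +_) (count-concatMap φ p xs))

  ∈⇒count>0 : ∀ {p l} → p ∈ l → 0 < count p l
  ∈⇒count>0 {p} p∈l = filter-some (_≟ p) (Any.map sym p∈l)

  count>0⇒∈ : ∀ {p} l → 0 < count p l → p ∈ l
  count>0⇒∈ {p} (x ∷ l) c>0 with x ≟ p
  ... | yes refl = here refl
  ... | no  _    = there (count>0⇒∈ l c>0)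

  ∉⇒count≡0 : ∀ {p l} → p ∉ l → count p l ≡ 0
  ∉⇒count≡0 {p} p∉l = cong length (filter-none (_≟ p) (¬Any⇒All¬ _ (λ q → p∉l (Any.map sym q))))

  count-expand : ∀ (c : A → ℕ) b xs → count b (concatMap (λ x → replicate (c x) x) xs) ≡ c b * count b xs
  count-expand c b []       = sym (*-zeroʳ (c b))
  count-expand c b (x ∷ xs) = step (x ≟ b)
    where
    rest = concatMap (λ y → replicate (c y) y) xs
    step : Dec (x ≡ b) → count b (replicate (c x) x ++ rest) ≡ c b * count b (x ∷ xs)
    step (yes refl) = begin
      count x (replicate (c x) x ++ rest)        ≡⟨ count-++ x (replicate (c x) x) rest ⟩
      count x (replicate (c x) x) + count x rest ≡⟨ cong₂ _+_ (count-replicate-same x (c x)) (count-expand c x xs) ⟩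
      c x + c x * count x xs                     ≡⟨ sym (*-suc (c x) (count x xs)) ⟩
      c x * suc (count x xs)                     ≡⟨ cong (c x *_) (sym (count-here x xs)) ⟩
      c x * count x (x ∷ xs)                     ∎
      where open ≡-Reasoning
    step (no x≢b) = begin
      count b (replicate (c x) x ++ rest)        ≡⟨ count-++ b (replicate (c x) x) rest ⟩
      count b (replicate (c x) x) + count b rest ≡⟨ cong₂ _+_ (count-replicate-other (c x) x≢b) (count-expand c b xs) ⟩
      c b * count b xs                           ≡⟨ cong (c b *_) (sym (count-there xs x≢b)) ⟩
      c b * count b (x ∷ xs)                     ∎
      where open ≡-Reasoning

  Unique⇒count≡1 : ∀ {x xs} → Unique xs → x ∈ xs → count x xs ≡ 1
  Unique⇒count≡1 {x} {x ∷ xs} (x∉ ∷ _) (here refl) =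
    trans (count-here x xs) (cong suc (∉⇒count≡0 (λ x∈ → All.lookup x∉ x∈ refl)))
  Unique⇒count≡1 {x} {y ∷ xs} (y∉ ∷ u) (there x∈) =
    trans (count-there xs (All.lookup y∉ x∈)) (Unique⇒count≡1 u x∈)

  _≋_ : List A → List A → Set
  l₁ ≋ l₂ = ∀ p → count p l₁ ≡ count p l₂

  remove : A → List A → List A
  remove x []      = []
  remove x (y ∷ l) with y ≟ x
  ... | yes _ = l
  ... | no  _ = y ∷ remove x l

  remove-here : ∀ x l → remove x (x ∷ l) ≡ l
  remove-here x l with x ≟ x
  ... | yes _   = refl
  ... | no  x≢x = ⊥-elim (x≢x refl)

  remove-there : ∀ {x y} l → y ≢ x → remove x (y ∷ l) ≡ y ∷ remove x l
  remove-there {x} {y} l y≢x with y ≟ x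
  ... | yes y≡x = ⊥-elim (y≢x y≡x)
  ... | no  _   = refl

  Σl-remove : ∀ (h : A → ℕ) {x} l → x ∈ l → Σl h l ≡ h x + Σl h (remove x l)
  Σl-remove h {x} (x ∷ l) (here refl) = cong (λ r → h x + Σl h r) (sym (remove-here x l))
  Σl-remove h {x} (y ∷ l) (there x∈) with y ≟ x
  ... | yes refl = refl
  ... | no  y≢x  = begin
    h y + Σl h l                        ≡⟨ cong (h y +_) (Σl-remove h l x∈) ⟩
    h y + (h x + Σl h (remove x l))     ≡⟨ +-exchange (h y) (h x) _ ⟩
    h x + (h y + Σl h (remove x l))     ∎
    where
    open ≡-Reasoning
    +-exchange : ∀ a b c → a + (b + c) ≡ b + (a + c)
    +-exchange a b c = trans (sym (+-assoc a b c)) (trans (cong (_+ c) (+-comm a b)) (+-assoc b a c))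

  count-remove-same : ∀ {x} l → x ∈ l → count x l ≡ suc (count x (remove x l))
  count-remove-same {x} (y ∷ l) x∈ = step (y ≟ x) x∈
    where
    step : Dec (y ≡ x) → x ∈ y ∷ l → count x (y ∷ l) ≡ suc (count x (remove x (y ∷ l)))
    step (yes refl) _ = trans (count-here x l) (cong (λ r → suc (count x r)) (sym (remove-here x l)))
    step (no y≢x) (here refl)  = ⊥-elim (y≢x refl)
    step (no y≢x) (there x∈l) = begin
      count x (y ∷ l)                    ≡⟨ count-there l y≢x ⟩
      count x l                          ≡⟨ count-remove-same l x∈l ⟩
      suc (count x (remove x l))         ≡⟨ cong suc (sym (count-there (remove x l) y≢x)) ⟩
      suc (count x (y ∷ remove x l))     ≡⟨ cong (λ r → suc (count x r)) (sym (remove-there l y≢x)) ⟩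
      suc (count x (remove x (y ∷ l)))   ∎
      where open ≡-Reasoning

  count-remove-other : ∀ {x p} l → x ≢ p → count p (remove x l) ≡ count p l
  count-remove-other {x} {p} []      x≢p = refl
  count-remove-other {x} {p} (y ∷ l) x≢p = step (y ≟ x)
    where
    step : Dec (y ≡ x) → count p (remove x (y ∷ l)) ≡ count p (y ∷ l)
    step (yes refl) = trans (cong (count p) (remove-here y l)) (sym (count-there l x≢p))
    step (no y≢x)   = begin
      count p (remove x (y ∷ l))     ≡⟨ cong (count p) (remove-there l y≢x) ⟩
      count p (y ∷ remove x l)       ≡⟨ count-∷ y p (remove x l) ⟩
      δ y p + count p (remove x l)   ≡⟨ cong (δ y p +_) (count-remove-other l x≢p) ⟩
      δ y p + count p l              ≡⟨ sym (count-∷ y p l) ⟩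
      count p (y ∷ l)                ∎
      where open ≡-Reasoning

  ≋⇒Σl : ∀ (h : A → ℕ) l₁ l₂ → l₁ ≋ l₂ → Σl h l₁ ≡ Σl h l₂
  ≋⇒Σl h []       []       e = refl
  ≋⇒Σl h []       (y ∷ l₂) e = ⊥-elim (0≢1+n (trans (e y) (count-here y l₂)))
  ≋⇒Σl h (x ∷ l₁) l₂       e =
    trans (cong (h x +_) (≋⇒Σl h l₁ (remove x l₂) e′)) (sym (Σl-remove h l₂ x∈l₂))
    where
    x∈l₂ : x ∈ l₂
    x∈l₂ = count>0⇒∈ l₂ (subst (0 <_) (trans (sym (count-here x l₁)) (e x)) (s≤s z≤n))
    e′ : l₁ ≋ remove x l₂
    e′ p with x ≟ p
    ... | yes refl = suc-injective (trans (sym (count-here x l₁)) (trans (e x) (count-remove-same l₂ x∈l₂)))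
    ... | no  x≢p  = trans (sym (count-there l₁ x≢p)) (trans (e p) (sym (count-remove-other l₂ x≢p)))

-- Such a list is
-- determined by its multiplicities, which is how partitions are compared
-- throughout; an arbitrary list is brought into this canonical form by
-- sorting it.
module Partitions where

  open import Data.Nat using (ℕ; zero; suc; _+_; _*_; _≤_; _≥_; _≟_; z≤n)
  open import Data.Nat.Properties
  open import Data.List using (List; []; _∷_; length; replicate; concatMap)
  open import Data.List.Properties using (length-filter)
  open import Data.Nat.ListAction using (sum)
  open import Data.Nat.ListAction.Properties using (sum-++; sum-↭)
  open import Data.List.Membership.Propositional using (_∈_; find)
  open import Data.List.Membership.Propositional.Properties using (∈-concatMap⁻)
  open import Data.List.Relation.Unary.Any using (here; there)
  open import Data.List.Relation.Unary.All using (All; []; _∷_)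
  import Data.List.Relation.Unary.All as All
  open import Data.List.Relation.Unary.Linked using (Linked; []; _∷_; tail)
  open import Data.List.Relation.Unary.Linked.Properties using (Linked⇒All)
  open import Data.List.Relation.Binary.Permutation.Propositional.Properties using (filter-↭; ↭-length; ∈-resp-↭)
  import Data.List.Sort as Sort
  import Relation.Binary.Construct.Flip.EqAndOrd as Flip
  open import Data.Product using (∃; _×_)
  open import Relation.Binary.PropositionalEquality
  open import Relation.Nullary using (yes; no)
  open Sums
  open Multiset _≟_ public

  Sorted : List ℕ → Set
  Sorted = Linked _≥_

  open Sort (Flip.decTotalOrder ≤-decTotalOrder) public using (sort)
  open Sort (Flip.decTotalOrder ≤-decTotalOrder) using (sort-↭; sort-↗)

  sort-sorted : ∀ l → Sorted (sort l)
  sort-sorted = sort-↗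

  count-sort : ∀ p l → count p (sort l) ≡ count p l
  count-sort p l = ↭-length (filter-↭ (_≟ p) (sort-↭ l))

  ∈-sort⁻ : ∀ {x} l → x ∈ sort l → x ∈ l
  ∈-sort⁻ l = ∈-resp-↭ (sort-↭ l)

  sum-sort : ∀ l → sum (sort l) ≡ sum l
  sum-sort l = sum-↭ (sort-↭ l)

  ≤-head : ∀ {x y l} → Sorted (x ∷ l) → y ∈ x ∷ l → y ≤ x
  ≤-head s y∈ = All.lookup (Linked⇒All (λ y≤x z≤y → ≤-trans z≤y y≤x) ≤-refl s) y∈

  ∈-≋ : ∀ {x} l₁ l₂ → l₁ ≋ l₂ → x ∈ l₁ → x ∈ l₂
  ∈-≋ {x} l₁ l₂ e x∈ = count>0⇒∈ l₂ (subst (0 <_) (e x) (∈⇒count>0 x∈))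

  ≋-∷ : ∀ x l₁ l₂ → (x ∷ l₁) ≋ (x ∷ l₂) → l₁ ≋ l₂
  ≋-∷ x l₁ l₂ e p =
    +-cancelˡ-≡ (δ x p) _ _ (trans (sym (count-∷ x p l₁)) (trans (e p) (count-∷ x p l₂)))

  canonical : ∀ l₁ l₂ → Sorted l₁ → Sorted l₂ → l₁ ≋ l₂ → l₁ ≡ l₂
  canonical []       []       _  _  _ = refl
  canonical []       (y ∷ l₂) _  _  e with ∈-≋ (y ∷ l₂) [] (λ p → sym (e p)) (here refl)
  ... | ()
  canonical (x ∷ l₁) []       _  _  e with ∈-≋ (x ∷ l₁) [] e (here refl)
  ... | ()
  canonical (x ∷ l₁) (y ∷ l₂) s₁ s₂ e with ≤-antisym x≤y y≤x
    where
    x≤y : x ≤ y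
    x≤y = ≤-head s₂ (∈-≋ (x ∷ l₁) (y ∷ l₂) e (here refl))
    y≤x : y ≤ x
    y≤x = ≤-head s₁ (∈-≋ (y ∷ l₂) (x ∷ l₁) (λ p → sym (e p)) (here refl))
  ... | refl = cong (x ∷_) (canonical l₁ l₂ (tail s₁) (tail s₂) (≋-∷ x l₁ l₂ e))

  sort-canonical : ∀ l₁ l₂ → Sorted l₂ → l₁ ≋ l₂ → sort l₁ ≡ l₂
  sort-canonical l₁ l₂ s e = canonical (sort l₁) l₂ (sort-sorted l₁) s (λ p → trans (count-sort p l₁) (e p))

  sum-replicate : ∀ k x → sum (replicate k x) ≡ k * x
  sum-replicate zero    x = refl
  sum-replicate (suc k) x = cong (x +_) (sum-replicate k x)

  sum-concatMap : ∀ {X : Set} (φ : X → List ℕ) xs → sum (concatMap φ xs) ≡ Σl (λ x → sum (φ x)) xs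
  sum-concatMap φ []       = refl
  sum-concatMap φ (x ∷ xs) = trans (sum-++ (φ x) (concatMap φ xs)) (cong (sum (φ x) +_) (sum-concatMap φ xs))

  ∈-concatMap : ∀ {X : Set} (φ : X → List ℕ) {y} xs → y ∈ concatMap φ xs → ∃ λ x → x ∈ xs × y ∈ φ x
  ∈-concatMap φ xs y∈ = find (∈-concatMap⁻ φ {xs = xs} y∈)

  ∈-replicate : ∀ {x y : ℕ} k → x ∈ replicate k y → x ≡ y
  ∈-replicate (suc k) (here x≡y)  = x≡y
  ∈-replicate (suc k) (there x∈) = ∈-replicate k x∈

  ∈⇒≤sum : ∀ {x} l → x ∈ l → x ≤ sum l
  ∈⇒≤sum (y ∷ l) (here refl) = m≤m+n y (sum l)
  ∈⇒≤sum (y ∷ l) (there x∈)  = ≤-trans (∈⇒≤sum l x∈) (m≤n+m (sum l) y)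

  count*≤sum : ∀ t l → count t l * t ≤ sum l
  count*≤sum t []      = z≤n
  count*≤sum t (y ∷ l) with y ≟ t
  ... | yes refl rewrite count-here y l = +-monoʳ-≤ y (count*≤sum y l)
  ... | no  y≢t  rewrite count-there l y≢t = ≤-trans (count*≤sum t l) (m≤n+m (sum l) y)

  count≤sum : ∀ t l → All (0 <_) l → count t l ≤ sum l
  count≤sum t l pos = ≤-trans (length-filter (_≟ t) l) (length≤sum l pos)
    where
    length≤sum : ∀ l → All (0 <_) l → length l ≤ sum l
    length≤sum []      []           = z≤n
    length≤sum (y ∷ l) (y>0 ∷ pos) = +-mono-≤ y>0 (length≤sum l pos)

module LinearForms where

  open import Data.Nat using (ℕ; zero; suc; _+_; _*_)
  open import Data.Nat.Properties using (+-identityʳ; +-comm; +-assoc)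
  open import Data.Nat.Tactic.RingSolver using (solve-∀)
  open import Data.Fin using (Fin)
  import Data.Fin as F
  open import Data.Vec.Functional using (tail; init; last)
  open import Data.List using (List; []; _∷_)
  open import Data.List.Membership.Propositional using (_∈_)
  open import Data.List.Relation.Unary.Any using (here; there)
  open import Data.Product using (_,_)
  open import Relation.Binary.PropositionalEquality
  open import Relation.Nullary using (yes; no)
  open import Data.Empty using (⊥-elim)
  open Sums

  lincomb-zero : ∀ {m} (a : Fin m → ℕ) → lincomb (λ _ → 0) a ≡ 0
  lincomb-zero {zero}  a = refl
  lincomb-zero {suc m} a = lincomb-zero (tail a)

  lincomb-cong : ∀ {m} (a : Fin m → ℕ) {x y : Fin m → ℕ} → (∀ i → x i ≡ y i) → lincomb x a ≡ lincomb y a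
  lincomb-cong {zero}  a e = refl
  lincomb-cong {suc m} a e = cong₂ _+_ (cong (_* a F.zero) (e F.zero)) (lincomb-cong (tail a) (λ i → e (F.suc i)))

  lincomb-+ : ∀ {m} (a x y : Fin m → ℕ) → lincomb (λ i → x i + y i) a ≡ lincomb x a + lincomb y a
  lincomb-+ {zero}  a x y = refl
  lincomb-+ {suc m} a x y
    rewrite lincomb-+ (tail a) (tail x) (tail y) =
    regroup (x F.zero) (y F.zero) (a F.zero) (lincomb (tail x) (tail a)) (lincomb (tail y) (tail a))
    where
    regroup : ∀ u v c X Y → (u + v) * c + (X + Y) ≡ u * c + X + (v * c + Y)
    regroup = solve-∀

  lincomb-Σl : ∀ {m} (a : Fin m → ℕ) {X : Set} (f : X → Fin m → ℕ) (l : List X) →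
    Σl (λ x → lincomb (f x) a) l ≡ lincomb (λ i → Σl (λ x → f x i) l) a
  lincomb-Σl a f []      = sym (lincomb-zero a)
  lincomb-Σl a f (x ∷ l) =
    trans (cong (lincomb (f x) a +_) (lincomb-Σl a f l)) (sym (lincomb-+ a (f x) (λ i → Σl (λ x → f x i) l)))

  unit : ∀ {m} → Fin m → ℕ → Fin m → ℕ
  unit j c i with i F.≟ j
  ... | yes _ = c
  ... | no  _ = 0

  unit-other : ∀ {m} {j i : Fin m} c → i ≢ j → unit j c i ≡ 0
  unit-other {j = j} {i} c i≢j with i F.≟ j
  ... | yes i≡j = ⊥-elim (i≢j i≡j)
  ... | no  _   = refl

  lincomb-unit : ∀ {m} (a : Fin m → ℕ) j c → lincomb (unit j c) a ≡ c * a j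
  lincomb-unit {suc m} a F.zero c =
    trans (cong (c * a F.zero +_)
                (trans (lincomb-cong (tail a) (λ i → unit-other {j = F.zero} {F.suc i} c (λ ()))) (lincomb-zero (tail a))))
          (+-identityʳ _)
  lincomb-unit {suc m} a (F.suc j) c = trans (lincomb-cong (tail a) shift) (lincomb-unit (tail a) j c)
    where
    shift : ∀ i → unit (F.suc j) c (F.suc i) ≡ unit j c i
    shift i with i F.≟ j
    ... | yes refl = refl
    ... | no  _    = refl

  lincomb-last : ∀ {m} (x a : Fin (suc m) → ℕ) → lincomb x a ≡ lincomb (init x) (init a) + last x * last a
  lincomb-last {zero}  x a = +-comm (x F.zero * a F.zero) 0
  lincomb-last {suc m} x a rewrite lincomb-last (tail x) (tail a) = sym (+-assoc (x F.zero * a F.zero) _ _)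

  S-zero : ∀ {m} (a : Fin m → ℕ) → InS a 0
  S-zero a = (λ _ → 0) , lincomb-zero a

  S-+ : ∀ {m} (a : Fin m → ℕ) {u v} → InS a u → InS a v → InS a (u + v)
  S-+ a (x , refl) (y , refl) = (λ i → x i + y i) , lincomb-+ a x y

  S-Σl : ∀ {m} (a : Fin m → ℕ) {X : Set} (h : X → ℕ) xs → (∀ x → x ∈ xs → InS a (h x)) → InS a (Σl h xs)
  S-Σl a h []       _  = S-zero a
  S-Σl a h (x ∷ xs) hS = S-+ a (hS x (here refl)) (S-Σl a h xs (λ y y∈ → hS y (there y∈)))

module Bijections where

  open import Data.Nat using (ℕ)
  open import Data.List using (List)
  open import Data.Product using (∃; _×_; _,_; proj₁; proj₂)
  open import Relation.Binary.PropositionalEquality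
  open import Relation.Binary.Bundles using (Setoid)
  open import Function.Bundles using (Bijection)
  open import Function.Properties.Bijection using (Bijection⇒Inverse)
  open import Function.Properties.Inverse using (Inverse⇒Bijection)
  import Function.Construct.Symmetry as Symmetry
  open import Level using (0ℓ)

  bijection-onto : (A : Setoid 0ℓ 0ℓ) (n : ℕ) (Q : List ℕ → Set) (f : Setoid.Carrier A → List ℕ) →
    (∀ x → IsPartition n (f x) × Q (f x)) →
    (∀ {x y} → Setoid._≈_ A x y → f x ≡ f y) →
    (∀ {x y} → f x ≡ f y → Setoid._≈_ A x y) →
    (∀ l → IsPartition n l × Q l → ∃ λ x → f x ≡ l) →
    Bijection A (Parts n Q)
  bijection-onto A n Q f valid resp reflect onto = record
    { to        = λ x → f x , valid x
    ; cong      = resp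
    ; bijective = reflect , λ y → let (x , fx≡y) = onto (proj₁ y) (proj₂ y) in x , λ x≈ → trans (resp x≈) fx≡y
    }

  inverse : {A B : Setoid 0ℓ 0ℓ} → Bijection A B → Bijection B A
  inverse b = Inverse⇒Bijection (Symmetry.inverse (Bijection⇒Inverse b))

-- A partition λ₁ ≥ … ≥ λ_k has as conjugate the partition in which the part
-- j occurs λ_j − λ_{j+1} times (λ_{k+1} = 0).  Hence the multiplicities of
-- the conjugate are the differences of consecutive parts of λ, and
-- conversely the parts of λ are sums of consecutive multiplicities of the
-- conjugate: λ_j is the number of parts ≥ j of the conjugate.  Since S(a) is
-- closed under addition, λ satisfies (i) iff its conjugate satisfies (ii).
module Conjugation where

  open import Data.Nat using (ℕ; zero; suc; _+_; _*_; _∸_; _<_; _≤_; _≥_; _≟_; _≤?_; z≤n; s≤s)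
  open import Data.Nat.Properties
  open import Data.Nat.Tactic.RingSolver using (solve-∀)
  open import Data.List using (List; []; _∷_; _++_; replicate; map)
  open import Data.Nat.ListAction using (sum)
  open import Data.Nat.ListAction.Properties using (sum-++)
  open import Data.List.Membership.Propositional using (_∈_)
  open import Data.List.Membership.Propositional.Properties using (∈-map⁻)
  open import Data.List.Relation.Unary.Any using (here; there)
  open import Data.List.Relation.Unary.All using (All; []; _∷_)
  import Data.List.Relation.Unary.All as All
  open import Data.List.Relation.Unary.Linked using ([]; [-]; _∷_; tail)
  open import Data.Fin using (Fin)
  open import Data.Product using (∃; _×_; _,_; proj₁; proj₂)
  open import Relation.Binary.Definitions using (tri<; tri≈; tri>)
  open import Data.Sum using (inj₁; inj₂)
  open import Relation.Binary.PropositionalEquality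
  open import Relation.Nullary using (yes; no)
  open import Data.Empty using (⊥-elim)
  open Sums
  open Partitions
  open LinearForms
  open Bijections

  -- the largest part (0 for the empty partition)
  hd : List ℕ → ℕ
  hd []      = 0
  hd (x ∷ _) = x

  hd-≤ : ∀ {x l} → Sorted (x ∷ l) → hd l ≤ x
  hd-≤ [-]        = z≤n
  hd-≤ (x≥y ∷ _) = x≥y

  -- the conjugate of a non-increasing list, with parts numbered from r
  conjFrom : ℕ → List ℕ → List ℕ
  conjFrom r []      = []
  conjFrom r (x ∷ l) = replicate (x ∸ hd l) r ++ conjFrom (suc r) l

  conj : List ℕ → List ℕ
  conj l = sort (conjFrom 1 l)

  count-conjFrom-below : ∀ {j r} l → j < r → count j (conjFrom r l) ≡ 0
  count-conjFrom-below         []      j<r = refl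
  count-conjFrom-below {j} {r} (x ∷ l) j<r =
    trans (count-++ j (replicate (x ∸ hd l) r) (conjFrom (suc r) l))
          (cong₂ _+_ (count-replicate-other (x ∸ hd l) (>⇒≢ j<r)) (count-conjFrom-below l (m<n⇒m<1+n j<r)))

  count-conjFrom-first : ∀ r x l → count r (conjFrom r (x ∷ l)) ≡ x ∸ hd l
  count-conjFrom-first r x l =
    trans (count-++ r (replicate (x ∸ hd l) r) (conjFrom (suc r) l))
          (trans (cong₂ _+_ (count-replicate-same r (x ∸ hd l)) (count-conjFrom-below l (n<1+n r))) (+-identityʳ _))

  count-conjFrom-other : ∀ {j r} x l → r ≢ j → count j (conjFrom r (x ∷ l)) ≡ count j (conjFrom (suc r) l)
  count-conjFrom-other {j} {r} x l r≢j =
    trans (count-++ j (replicate (x ∸ hd l) r) (conjFrom (suc r) l))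
          (cong (_+ count j (conjFrom (suc r) l)) (count-replicate-other (x ∸ hd l) r≢j))

  conjFrom-≥ : ∀ {y} r l → y ∈ conjFrom r l → r ≤ y
  conjFrom-≥ r l y∈ = ≮⇒≥ (λ y<r → <-irrefl (sym (count-conjFrom-below l y<r)) (∈⇒count>0 y∈))

  -- conjugation preserves the sum: Σ_j (r + j)(λ_j − λ_{j+1}) = Σ_j λ_j + r·λ_1
  sum-conjFrom : ∀ r l → Sorted l → sum (conjFrom (suc r) l) ≡ sum l + r * hd l
  sum-conjFrom r []      s = sym (*-zeroʳ r)
  sum-conjFrom r (x ∷ l) s = begin
    sum (replicate (x ∸ hd l) (suc r) ++ conjFrom (suc (suc r)) l)
      ≡⟨ sum-++ (replicate (x ∸ hd l) (suc r)) _ ⟩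
    sum (replicate (x ∸ hd l) (suc r)) + sum (conjFrom (suc (suc r)) l)
      ≡⟨ cong₂ _+_ (sum-replicate (x ∸ hd l) (suc r)) (sum-conjFrom (suc r) l (tail s)) ⟩
    (x ∸ hd l) * suc r + (sum l + suc r * hd l)
      ≡⟨ regroup (x ∸ hd l) (hd l) (sum l) r ⟩
    (x ∸ hd l) + hd l + sum l + r * ((x ∸ hd l) + hd l)
      ≡⟨ cong (λ z → z + sum l + r * z) (m∸n+n≡m (hd-≤ s)) ⟩
    x + sum l + r * x ∎
    where
    open ≡-Reasoning
    regroup : ∀ d h S r → d * suc r + (S + suc r * h) ≡ d + h + S + r * (d + h)
    regroup = solve-∀

  conjFrom-nonempty : ∀ r {x l} → Sorted (x ∷ l) → All (0 <_) (x ∷ l) → ∃ λ z → z ∈ conjFrom r (x ∷ l)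
  conjFrom-nonempty r {x} {l} s (x>0 ∷ pos) with x ∸ hd l in eq
  ... | suc _ = r , here refl
  conjFrom-nonempty r {x} {[]}    s (x>0 ∷ pos) | zero = ⊥-elim (<-irrefl (sym eq) x>0)
  conjFrom-nonempty r {x} {y ∷ l} s (x>0 ∷ pos) | zero = conjFrom-nonempty (suc r) (tail s) pos

  conjFrom-injective : ∀ r l₁ l₂ → Sorted l₁ → Sorted l₂ → All (0 <_) l₁ → All (0 <_) l₂ →
    conjFrom r l₁ ≋ conjFrom r l₂ → l₁ ≡ l₂
  conjFrom-injective r []       []       _  _  _  _  _ = refl
  conjFrom-injective r []       (y ∷ l₂) _  s₂ _  p₂ e with conjFrom-nonempty r s₂ p₂
  ... | z , z∈ with ∈-≋ (conjFrom r (y ∷ l₂)) [] (λ p → sym (e p)) z∈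
  ... | ()
  conjFrom-injective r (x ∷ l₁) []       s₁ _  p₁ _  e with conjFrom-nonempty r s₁ p₁
  ... | z , z∈ with ∈-≋ (conjFrom r (x ∷ l₁)) [] e z∈
  ... | ()
  conjFrom-injective r (x ∷ l₁) (y ∷ l₂) s₁ s₂ (_ ∷ p₁) (_ ∷ p₂) e
    with conjFrom-injective (suc r) l₁ l₂ (tail s₁) (tail s₂) p₁ p₂ tails-≋
    where
    tails-≋ : conjFrom (suc r) l₁ ≋ conjFrom (suc r) l₂
    tails-≋ j with r ≟ j
    ... | yes refl = trans (count-conjFrom-below l₁ (n<1+n r)) (sym (count-conjFrom-below l₂ (n<1+n r)))
    ... | no  r≢j  = trans (sym (count-conjFrom-other x l₁ r≢j)) (trans (e j) (count-conjFrom-other y l₂ r≢j))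
  ... | refl = cong (_∷ l₁) (∸-cancelʳ-≡ (hd-≤ s₁) (hd-≤ s₂)
                 (trans (sym (count-conjFrom-first r x l₁)) (trans (e r) (count-conjFrom-first r y l₁))))

  module _ {m : ℕ} (a : Fin m → ℕ) where

    CondI-tail : ∀ {x l} → CondI a (x ∷ l) → CondI a l
    CondI-tail (parts , diffs) = (λ p p∈ → parts p (there p∈)) , (λ u v u∈ v∈ → diffs u v (there u∈) (there v∈))

    CondI-step : ∀ {x l} → Sorted (x ∷ l) → CondI a (x ∷ l) → InS a (x ∸ hd l)
    CondI-step {l = []}    _ (parts , _)     = parts _ (here refl)
    CondI-step {l = y ∷ _} s (_     , diffs) = diffs _ y (here refl) (there (here refl)) (hd-≤ s)

    count-conjFrom-S : ∀ r l → Sorted l → CondI a l → ∀ j → InS a (count j (conjFrom r l))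
    count-conjFrom-S r []      s cI j = S-zero a
    count-conjFrom-S r (x ∷ l) s cI j =
      subst (InS a) (sym (count-++ j (replicate (x ∸ hd l) r) (conjFrom (suc r) l)))
        (S-+ a (replicate-S (CondI-step s cI)) (count-conjFrom-S (suc r) l (tail s) (CondI-tail cI) j))
      where
      replicate-S : ∀ {c} → InS a c → InS a (count j (replicate c r))
      replicate-S {c} c∈S with r ≟ j
      ... | yes refl = subst (InS a) (sym (count-replicate-same r c)) c∈S
      ... | no  r≢j  = subst (InS a) (sym (count-replicate-other c r≢j)) (S-zero a)

    -- (ii) says that every multiplicity, including 0, lies in S(a)
    CondII⇒count-S : ∀ l → CondII a l → ∀ t → InS a (count t l)
    CondII⇒count-S l cII t with count t l in eq
    ... | zero  = S-zero a
    ... | suc c = subst (InS a) eq (cII t (count>0⇒∈ l (subst (0 <_) (sym eq) (s≤s z≤n))))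

  atLeast₁ : ℕ → ℕ → ℕ
  atLeast₁ zero    y       = 1
  atLeast₁ (suc r) zero    = 0
  atLeast₁ (suc r) (suc y) = atLeast₁ r y

  atLeast₁-yes : ∀ {r y} → r ≤ y → atLeast₁ r y ≡ 1
  atLeast₁-yes {zero}           _         = refl
  atLeast₁-yes {suc r} {suc y} (s≤s r≤y) = atLeast₁-yes r≤y

  atLeast₁-no : ∀ {r y} → y < r → atLeast₁ r y ≡ 0
  atLeast₁-no {suc r} {zero}  _         = refl
  atLeast₁-no {suc r} {suc y} (s≤s y<r) = atLeast₁-no y<r

  atLeast₁-split : ∀ r y → atLeast₁ r y ≡ δ y r + atLeast₁ (suc r) y
  atLeast₁-split r y with <-cmp y r
  ... | tri< y<r _ _ rewrite atLeast₁-no y<r | δ-other (<⇒≢ y<r) | atLeast₁-no (m<n⇒m<1+n y<r) = refl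
  ... | tri≈ _ refl _ rewrite atLeast₁-yes (≤-refl {y}) | δ-same y | atLeast₁-no (n<1+n y) = refl
  ... | tri> _ _ r<y rewrite atLeast₁-yes (<⇒≤ r<y) | δ-other (>⇒≢ r<y) | atLeast₁-yes r<y = refl

  range : ℕ → ℕ → List ℕ
  range r zero    = []
  range r (suc K) = r ∷ range (suc r) K

  atLeast : ℕ → List ℕ → ℕ
  atLeast r l = Σl (atLeast₁ r) l

  atLeast-split : ∀ r l → atLeast r l ≡ count r l + atLeast (suc r) l
  atLeast-split r l =
    trans (Σl-cong l (λ y _ → atLeast₁-split r y))
          (trans (Σl-+ (λ y → δ y r) (atLeast₁ (suc r)) l) (cong (_+ atLeast (suc r) l) (Σl-δ r l)))

  atLeast-zero : ∀ r l → (∀ y → y ∈ l → y < r) → atLeast r l ≡ 0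
  atLeast-zero r []      small = refl
  atLeast-zero r (y ∷ l) small =
    cong₂ _+_ (atLeast₁-no (small y (here refl))) (atLeast-zero r l (λ z z∈ → small z (there z∈)))

  atLeast-pos : ∀ {x} r l → x ∈ l → r ≤ x → 0 < atLeast r l
  atLeast-pos r (y ∷ l) (here refl) r≤y rewrite atLeast₁-yes r≤y = s≤s z≤n
  atLeast-pos r (y ∷ l) (there x∈)  r≤x = <-≤-trans (atLeast-pos r l x∈ r≤x) (m≤n+m _ _)

  atLeast-window : ∀ l {r s} → r ≤ s → atLeast r l ≡ Σl (λ j → count j l) (range r (s ∸ r)) + atLeast s l
  atLeast-window l {r} {s} r≤s =
    trans (window r (s ∸ r)) (cong (λ t → Σl (λ j → count j l) (range r (s ∸ r)) + atLeast t l) (m+[n∸m]≡n r≤s))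
    where
    window : ∀ r k → atLeast r l ≡ Σl (λ j → count j l) (range r k) + atLeast (r + k) l
    window r zero    = cong (λ t → atLeast t l) (sym (+-identityʳ r))
    window r (suc k) = begin
      atLeast r l
        ≡⟨ atLeast-split r l ⟩
      count r l + atLeast (suc r) l
        ≡⟨ cong (count r l +_) (window (suc r) k) ⟩
      count r l + (Σl (λ j → count j l) (range (suc r) k) + atLeast (suc r + k) l)
        ≡⟨ sym (+-assoc (count r l) _ _) ⟩
      count r l + Σl (λ j → count j l) (range (suc r) k) + atLeast (suc r + k) l
        ≡⟨ cong (λ t → Σl (λ j → count j l) (range r (suc k)) + atLeast t l) (sym (+-suc r k)) ⟩
      Σl (λ j → count j l) (range r (suc k)) + atLeast (r + suc k) l ∎
      where open ≡-Reasoning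

  atLeast-antitone : ∀ l {r s} → r ≤ s → atLeast s l ≤ atLeast r l
  atLeast-antitone l r≤s = subst (_ ≤_) (sym (atLeast-window l r≤s)) (m≤n+m _ _)

  module _ {m : ℕ} (a : Fin m → ℕ) (μ : List ℕ) (counts-S : ∀ t → InS a (count t μ)) where

    atLeast-diff-S : ∀ r s → InS a (atLeast r μ ∸ atLeast s μ)
    atLeast-diff-S r s with r ≤? s
    ... | yes r≤s = subst (InS a) (sym (trans (cong (_∸ atLeast s μ) (atLeast-window μ r≤s)) (m+n∸n≡m _ (atLeast s μ))))
                      (S-Σl a (λ j → count j μ) (range r (s ∸ r)) (λ j _ → counts-S j))
    ... | no  r≰s = subst (InS a) (sym (m≤n⇒m∸n≡0 (atLeast-antitone μ (<⇒≤ (≰⇒> r≰s))))) (S-zero a)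

    atLeast-S : ∀ r → InS a (atLeast r μ)
    atLeast-S r = subst (InS a) (cong (atLeast r μ ∸_) (atLeast-zero (suc (sum μ)) μ (λ y y∈ → s≤s (∈⇒≤sum μ y∈))))
                    (atLeast-diff-S r (suc (sum μ)))

  module _ (f : ℕ → ℕ) where

    hd-map-range : ∀ r K → f (r + K) ≡ 0 → hd (map f (range r K)) ≡ f r
    hd-map-range r zero    f[r]≡0 = sym (trans (cong f (sym (+-identityʳ r))) f[r]≡0)
    hd-map-range r (suc K) _      = refl

    count-conjFrom-range : ∀ K r → (∀ j → r + K ≤ j → f j ≡ 0) →
      ∀ j → r ≤ j → count j (conjFrom r (map f (range r K))) ≡ f j ∸ f (suc j)
    count-conjFrom-range zero    r vanish j r≤j =
      sym (trans (cong (_∸ f (suc j)) (vanish j (subst (_≤ j) (sym (+-identityʳ r)) r≤j))) (0∸n≡0 (f (suc j))))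
    count-conjFrom-range (suc K) r vanish j r≤j with m≤n⇒m<n∨m≡n r≤j
    ... | inj₂ refl = trans (count-conjFrom-first r (f r) (map f (range (suc r) K)))
                        (cong (f r ∸_) (hd-map-range (suc r) K (vanish (suc r + K) (≤-reflexive (+-suc r K)))))
    ... | inj₁ r<j  = trans (count-conjFrom-other (f r) (map f (range (suc r) K)) (<⇒≢ r<j))
                        (count-conjFrom-range K (suc r) (λ j′ le → vanish j′ (subst (_≤ j′) (sym (+-suc r K)) le)) j r<j)

    map-range-sorted : (∀ j → f (suc j) ≤ f j) → ∀ r K → Sorted (map f (range r K))
    map-range-sorted antitone r zero          = []
    map-range-sorted antitone r (suc zero)    = [-]
    map-range-sorted antitone r (suc (suc K)) = antitone r ∷ map-range-sorted antitone (suc r) (suc K)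

    map-range-pos : ∀ r K → (∀ j → r ≤ j → j < r + K → 0 < f j) → All (0 <_) (map f (range r K))
    map-range-pos r zero    _   = []
    map-range-pos r (suc K) pos =
      pos r ≤-refl (subst (r <_) (sym (+-suc r K)) (s≤s (m≤m+n r K)))
      ∷ map-range-pos (suc r) K (λ j r<j j<r+K → pos j (<⇒≤ r<j) (subst (j <_) (sym (+-suc r K)) j<r+K))

  conjInv : List ℕ → List ℕ
  conjInv μ = map (λ j → atLeast j μ) (range 1 (hd μ))

  module _ (μ : List ℕ) (s : Sorted μ) (pos : All (0 <_) μ) where

    conjInv-sorted : Sorted (conjInv μ)
    conjInv-sorted = map-range-sorted (λ j → atLeast j μ) (λ j → atLeast-antitone μ (n≤1+n j)) 1 (hd μ)

    conjInv-pos : All (0 <_) (conjInv μ)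
    conjInv-pos = map-range-pos (λ j → atLeast j μ) 1 (hd μ) (atLeast-pos′ μ s)
      where
      atLeast-pos′ : ∀ μ → Sorted μ → ∀ j → 1 ≤ j → j < 1 + hd μ → 0 < atLeast j μ
      atLeast-pos′ []      _ (suc j) _ (s≤s ())
      atLeast-pos′ (y ∷ μ) _ j       _ (s≤s j≤y) = atLeast-pos j (y ∷ μ) (here refl) j≤y

    conjFrom-conjInv : conjFrom 1 (conjInv μ) ≋ μ
    conjFrom-conjInv zero    = trans (count-conjFrom-below (conjInv μ) (s≤s z≤n))
                                     (sym (∉⇒count≡0 (λ 0∈ → <-irrefl refl (All.lookup pos 0∈))))
    conjFrom-conjInv (suc p) =
      trans (count-conjFrom-range (λ j → atLeast j μ) (hd μ) 1 beyond-hd (suc p) (s≤s z≤n))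
            (trans (cong (_∸ atLeast (suc (suc p)) μ) (atLeast-split (suc p) μ)) (m+n∸n≡m _ (atLeast (suc (suc p)) μ)))
      where
      beyond-hd : ∀ j → 1 + hd μ ≤ j → atLeast j μ ≡ 0
      beyond-hd j hd<j = atLeast-zero j μ (λ y y∈ → <-≤-trans (s≤s (hd-max μ s y∈)) hd<j)
        where
        hd-max : ∀ μ → Sorted μ → ∀ {y} → y ∈ μ → y ≤ hd μ
        hd-max (x ∷ μ) s y∈ = ≤-head s y∈

  module _ {m : ℕ} (a : Fin m → ℕ) (n : ℕ) where

    conj-valid : ∀ l → IsPartition n l × CondI a l → IsPartition n (conj l) × CondII a (conj l)
    conj-valid l ((s , pos , Σ≡n) , cI) =
      ( sort-sorted (conjFrom 1 l)
      , All.tabulate (λ y∈ → conjFrom-≥ 1 l (∈-sort⁻ (conjFrom 1 l) y∈))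
      , trans (sum-sort (conjFrom 1 l)) (trans (sum-conjFrom 0 l s) (trans (+-identityʳ _) Σ≡n)) )
      , λ p _ → subst (InS a) (sym (count-sort p (conjFrom 1 l))) (count-conjFrom-S a 1 l s cI p)

    conj-injective : ∀ l₁ l₂ → IsPartition n l₁ × CondI a l₁ → IsPartition n l₂ × CondI a l₂ →
      conj l₁ ≡ conj l₂ → l₁ ≡ l₂
    conj-injective l₁ l₂ ((s₁ , p₁ , _) , _) ((s₂ , p₂ , _) , _) e =
      conjFrom-injective 1 l₁ l₂ s₁ s₂ p₁ p₂
        (λ p → trans (sym (count-sort p (conjFrom 1 l₁))) (trans (cong (count p) e) (count-sort p (conjFrom 1 l₂))))

    conj-onto : ∀ μ → IsPartition n μ × CondII a μ → ∃ λ l → (IsPartition n l × CondI a l) × conj l ≡ μ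
    conj-onto μ ((s , pos , Σ≡n) , cII) =
      conjInv μ , ((conjInv-sorted μ s pos , conjInv-pos μ s pos , sum-conjInv) , (parts-S , diffs-S)) , image
      where
      image : conj (conjInv μ) ≡ μ
      image = sort-canonical (conjFrom 1 (conjInv μ)) μ s (conjFrom-conjInv μ s pos)
      sum-conjInv : sum (conjInv μ) ≡ n
      sum-conjInv = begin
        sum (conjInv μ)                   ≡⟨ sym (+-identityʳ _) ⟩
        sum (conjInv μ) + 0               ≡⟨ sym (sum-conjFrom 0 (conjInv μ) (conjInv-sorted μ s pos)) ⟩
        sum (conjFrom 1 (conjInv μ))      ≡⟨ sym (sum-sort _) ⟩
        sum (conj (conjInv μ))            ≡⟨ cong sum image ⟩
        sum μ                             ≡⟨ Σ≡n ⟩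
        n                                 ∎
        where open ≡-Reasoning
      counts-S = CondII⇒count-S a μ cII
      parts-S : ∀ p → p ∈ conjInv μ → InS a p
      parts-S p p∈ with ∈-map⁻ (λ j → atLeast j μ) p∈
      ... | j , _ , refl = atLeast-S a μ counts-S j
      diffs-S : ∀ u v → u ∈ conjInv μ → v ∈ conjInv μ → v ≤ u → InS a (u ∸ v)
      diffs-S u v u∈ v∈ _ with ∈-map⁻ (λ j → atLeast j μ) u∈ | ∈-map⁻ (λ j → atLeast j μ) v∈
      ... | j , _ , refl | k , _ , refl = atLeast-diff-S a μ counts-S j k

    bijection-I-II : SameCard (Parts n (CondI a)) (Parts n (CondII a))
    bijection-I-II = bijection-onto (Parts n (CondI a)) n (CondII a) (λ x → conj (proj₁ x))
      (λ x → conj-valid (proj₁ x) (proj₂ x)) (cong conj)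
      (λ {x} {y} → conj-injective (proj₁ x) (proj₁ y) (proj₂ x) (proj₂ y))
      (λ μ valid → let (l , l-valid , conj≡μ) = conj-onto μ valid in (l , l-valid) , conj≡μ)

-- Put g_i = gcd(a_0, …, a_{i-1}) and D_i = lcm(g_i, a_i) / a_i.  Call a
-- coefficient vector x bounded if x_i < D_i for every i ≥ 1 (x_0 is free).
module BoundedRepresentations where

  open import Data.Nat using (ℕ; zero; suc; _+_; _*_; _∸_; _<_; _≤_; z≤n; s≤s; NonZero; >-nonZero)
  open import Data.Nat.Properties
  open import Data.Nat.Tactic.RingSolver using (solve-∀)
  open import Data.Nat.Divisibility using (_∣_; divides; ∣-trans; ∣m+n∣m⇒∣n; n∣m*n; ∣m∣n⇒∣m+n; ∣n⇒∣m*n; >⇒∤)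
  open import Data.Nat.GCD using (gcd; gcd[m,n]∣m; gcd[m,n]∣n; gcd[m,n]≢0)
  open import Data.Nat.LCM using (lcm; m∣lcm[m,n]; n∣lcm[m,n]; lcm-least; gcd*lcm)
  open import Data.Nat.DivMod using (_/_; _%_; m≡m%n+[m/n]*n; m%n<n)
  open import Data.Fin using (Fin; toℕ; inject₁; fromℕ)
  import Data.Fin as F
  open import Data.Fin.Properties using (toℕ-inject₁; toℕ-fromℕ; toℕ<n)
  open import Data.Fin.Relation.Unary.Top using (View; view; ‵fromℕ; ‵inj₁; view-fromℕ; view-inject₁)
  open import Data.Vec.Functional using (init)
  open import Data.Product using (∃; _×_; _,_; proj₁; proj₂)
  open import Data.Sum using (inj₁; inj₂)
  open import Relation.Binary.PropositionalEquality
  open import Data.Empty using (⊥-elim)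
  open LinearForms

  D : ∀ {m} → (Fin m → ℕ) → Fin m → ℕ
  D a i = _∣_.quotient (n∣lcm[m,n] (gcdFirst a (toℕ i)) (a i))

  D-spec : ∀ {m} (a : Fin m → ℕ) i → lcm (gcdFirst a (toℕ i)) (a i) ≡ D a i * a i
  D-spec a i = _∣_.equality (n∣lcm[m,n] (gcdFirst a (toℕ i)) (a i))

  Bounded : ∀ {m} → (Fin m → ℕ) → (Fin m → ℕ) → Set
  Bounded a x = ∀ i → 1 ≤ toℕ i → x i < D a i

  gcdFirst-∣ : ∀ {m} (a : Fin m → ℕ) k (j : Fin m) → toℕ j < k → gcdFirst a k ∣ a j
  gcdFirst-∣ {suc m} a (suc k) F.zero    _         = gcd[m,n]∣m (a F.zero) _
  gcdFirst-∣ {suc m} a (suc k) (F.suc j) (s≤s j<k) =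
    ∣-trans (gcd[m,n]∣n (a F.zero) _) (gcdFirst-∣ (λ i → a (F.suc i)) k j j<k)

  gcdFirst-pos : ∀ {m} (a : Fin (suc m) → ℕ) k → 1 ≤ k → 0 < a F.zero → 0 < gcdFirst a k
  gcdFirst-pos a (suc k) _ a₀>0 = n≢0⇒n>0 (gcd[m,n]≢0 (a F.zero) _ (inj₁ (λ a₀≡0 → <-irrefl (sym a₀≡0) a₀>0)))

  gcdFirst-init : ∀ {m} (a : Fin (suc m) → ℕ) k → k ≤ m → gcdFirst (init a) k ≡ gcdFirst a k
  gcdFirst-init {zero}  a zero    _         = refl
  gcdFirst-init {suc m} a zero    _         = refl
  gcdFirst-init {suc m} a (suc k) (s≤s k≤m) = cong (gcd (a F.zero)) (gcdFirst-init (λ i → a (F.suc i)) k k≤m)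

  D-init : ∀ {m} (a : Fin (suc m) → ℕ) i → D (init a) i ≡ D a (inject₁ i)
  D-init {m} a i = cong (λ g → _∣_.quotient (n∣lcm[m,n] g (a (inject₁ i))))
    (trans (gcdFirst-init a (toℕ i) (<⇒≤ (toℕ<n i))) (cong (gcdFirst a) (sym (toℕ-inject₁ i))))

  lcm-pos : ∀ {x y} → 0 < x → 0 < y → 0 < lcm x y
  lcm-pos {x} {y} x>0 y>0 = n≢0⇒n>0 λ lcm≡0 → <-irrefl
    (sym (trans (sym (gcd*lcm x y)) (trans (cong (gcd x y *_) lcm≡0) (*-zeroʳ (gcd x y)))))
    (*-mono-< x>0 y>0)

  -- D_i is positive for i ≥ 1 (for i = 0, g_0 = 0 and D_0 = 0)
  D-pos : ∀ {m} (a : Fin m → ℕ) → (∀ i → 0 < a i) → ∀ i → 1 ≤ toℕ i → 0 < D a i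
  D-pos {suc m} a pos i i≥1 = n≢0⇒n>0 λ D≡0 → <-irrefl
    (sym (trans (D-spec a i) (cong (_* a i) D≡0)))
    (lcm-pos (gcdFirst-pos a (toℕ i) i≥1 (pos F.zero)) (pos i))

  Bounded-init : ∀ {m} (a x : Fin (suc m) → ℕ) → Bounded a x → Bounded (init a) (init x)
  Bounded-init a x bx i i≥1 = subst (x (inject₁ i) <_) (sym (D-init a i))
    (bx (inject₁ i) (subst (1 ≤_) (sym (toℕ-inject₁ i)) i≥1))

  below-last : ∀ {m} (j : Fin (suc m)) → toℕ j < m → ∃ λ j′ → inject₁ j′ ≡ j
  below-last j j<m with view j
  ... | ‵fromℕ   = ⊥-elim (<-irrefl (toℕ-fromℕ _) j<m)
  ... | ‵inj₁ {i = j′} _ = j′ , refl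

  CondStar-init : ∀ {m} (a : Fin (suc m) → ℕ) → CondStar a → CondStar (init a)
  CondStar-init {m} a st i i≥1 with st (inject₁ i) (subst (1 ≤_) (sym (toℕ-inject₁ i)) i≥1)
  ... | j , j<i , lcm-eq with below-last j (<-trans j<i′ (toℕ<n i))
    where
    j<i′ : toℕ j < toℕ i
    j<i′ = subst (toℕ j <_) (toℕ-inject₁ i) j<i
  ... | j′ , refl =
    j′ , subst (_< toℕ i) (toℕ-inject₁ j′) (subst (toℕ (inject₁ j′) <_) (toℕ-inject₁ i) j<i) ,
    trans (cong (λ g → lcm g (a (inject₁ i)))
            (trans (gcdFirst-init a (toℕ i) (<⇒≤ (toℕ<n i))) (cong (gcdFirst a) (sym (toℕ-inject₁ i)))))
          lcm-eq

  lincomb-∣ : ∀ {m} (a x : Fin m → ℕ) {d} → (∀ i → d ∣ a i) → d ∣ lincomb x a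
  lincomb-∣ {zero}  a x d∣a = divides 0 refl
  lincomb-∣ {suc m} a x d∣a =
    ∣m∣n⇒∣m+n (∣n⇒∣m*n (x F.zero) (d∣a F.zero))
              (lincomb-∣ (λ i → a (F.suc i)) (λ i → x (F.suc i)) (λ i → d∣a (F.suc i)))

  ∣-<⇒≡0 : ∀ {d z} → d ∣ z → z < d → z ≡ 0
  ∣-<⇒≡0 {z = zero}  _   _   = refl
  ∣-<⇒≡0 {z = suc z} d∣z z<d = ⊥-elim (>⇒∤ z<d d∣z)

  -- If L + X ≡ L′ + Y where g divides L and L′, c divides X and Y, and
  -- X ≤ Y < lcm g c, then X ≡ Y: Y − X is a multiple of g and of c below lcm g c.
  lcm-separation-≤ : ∀ {g c L L′ X Y} → g ∣ L → g ∣ L′ → c ∣ X → c ∣ Y → Y < lcm g c →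
    L + X ≡ L′ + Y → X ≤ Y → X ≡ Y
  lcm-separation-≤ {g} {c} {L} {L′} {X} {Y} g∣L g∣L′ c∣X c∣Y Y<l e X≤Y =
    ≤-antisym X≤Y (m∸n≡0⇒m≤n (∣-<⇒≡0 (lcm-least g∣Z c∣Z) (≤-<-trans (m∸n≤m Y X) Y<l)))
    where
    Y≡X+Z : Y ≡ X + (Y ∸ X)
    Y≡X+Z = sym (m+[n∸m]≡n X≤Y)
    L≡L′+Z : L ≡ L′ + (Y ∸ X)
    L≡L′+Z = +-cancelʳ-≡ X L (L′ + (Y ∸ X)) (trans e (trans (cong (L′ +_) Y≡X+Z) (regroup L′ X (Y ∸ X))))
      where
      regroup : ∀ u v w → u + (v + w) ≡ u + w + v
      regroup = solve-∀
    g∣Z : g ∣ Y ∸ X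
    g∣Z = ∣m+n∣m⇒∣n (subst (g ∣_) L≡L′+Z g∣L) g∣L′
    c∣Z : c ∣ Y ∸ X
    c∣Z = ∣m+n∣m⇒∣n (subst (c ∣_) Y≡X+Z c∣Y) c∣X

  lcm-separation : ∀ {g c L L′ X Y} → g ∣ L → g ∣ L′ → c ∣ X → c ∣ Y →
    X < lcm g c → Y < lcm g c → L + X ≡ L′ + Y → X ≡ Y
  lcm-separation {X = X} {Y} g∣L g∣L′ c∣X c∣Y X<l Y<l e with ≤-total X Y
  ... | inj₁ X≤Y = lcm-separation-≤ g∣L g∣L′ c∣X c∣Y Y<l e X≤Y
  ... | inj₂ Y≤X = sym (lcm-separation-≤ g∣L′ g∣L c∣Y c∣X X<l (sym e) Y≤X)

  snoc : ∀ {m} → (Fin m → ℕ) → ℕ → Fin (suc m) → ℕ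
  snoc f v i with view i
  ... | ‵fromℕ           = v
  ... | ‵inj₁ {i = j} _  = f j

  snoc-last : ∀ {m} (f : Fin m → ℕ) v → snoc f v (fromℕ m) ≡ v
  snoc-last {m} f v rewrite view-fromℕ m = refl

  snoc-init : ∀ {m} (f : Fin m → ℕ) v j → snoc f v (inject₁ j) ≡ f j
  snoc-init f v j rewrite view-inject₁ j = refl

  module _ {m : ℕ} (a : Fin (suc (suc m)) → ℕ) (pos : ∀ i → 0 < a i) where

    private
      t : Fin (suc (suc m))
      t = fromℕ (suc m)

    last-≥1 : 1 ≤ toℕ t
    last-≥1 = subst (1 ≤_) (sym (toℕ-fromℕ (suc m))) (s≤s z≤n)

    gcdFirst-∣-init : ∀ k → gcdFirst a (toℕ t) ∣ init a k
    gcdFirst-∣-init k = gcdFirst-∣ a (toℕ t) (inject₁ k)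
      (subst₂ _<_ (sym (toℕ-inject₁ k)) (sym (toℕ-fromℕ (suc m))) (toℕ<n k))

    last-bound : ∀ z → Bounded a z → z t * a t < lcm (gcdFirst a (toℕ t)) (a t)
    last-bound z bz = subst (z t * a t <_) (sym (D-spec a t)) (*-monoˡ-< (a t) {{>-nonZero (pos t)}} (bz t last-≥1))

    last-split : ∀ {x y} → Bounded a x → Bounded a y → lincomb x a ≡ lincomb y a →
      x t ≡ y t × lincomb (init x) (init a) ≡ lincomb (init y) (init a)
    last-split {x} {y} bx by e = *-cancelʳ-≡ (x t) (y t) (a t) {{>-nonZero (pos t)}} last-eq , init-eq
      where
      split : lincomb (init x) (init a) + x t * a t ≡ lincomb (init y) (init a) + y t * a t
      split = trans (sym (lincomb-last x a)) (trans e (lincomb-last y a))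
      last-eq : x t * a t ≡ y t * a t
      last-eq = lcm-separation (lincomb-∣ (init a) (init x) gcdFirst-∣-init) (lincomb-∣ (init a) (init y) gcdFirst-∣-init)
                               (n∣m*n (x t)) (n∣m*n (y t)) (last-bound x bx) (last-bound y by) split
      init-eq : lincomb (init x) (init a) ≡ lincomb (init y) (init a)
      init-eq = +-cancelʳ-≡ (x t * a t) _ _ (trans split (cong (lincomb (init y) (init a) +_) (sym last-eq)))

  -- bounded representations are unique; the proof recurses on the position
  -- of the coordinate in question, as exposed by the view of Fin (suc m)
  bounded-unique-at : ∀ {m} (a : Fin m → ℕ) → (∀ i → 0 < a i) → ∀ {x y} → Bounded a x → Bounded a y →
    lincomb x a ≡ lincomb y a → ∀ {i} → View i → x i ≡ y i
  bounded-unique-at {suc zero}    a pos _  _  e ‵fromℕ =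
    *-cancelʳ-≡ _ _ (a F.zero) {{>-nonZero (pos F.zero)}} (+-cancelʳ-≡ 0 _ _ e)
  bounded-unique-at {suc zero}    a pos _  _  e (‵inj₁ {i = ()} _)
  bounded-unique-at {suc (suc m)} a pos bx by e ‵fromℕ    = proj₁ (last-split a pos bx by e)
  bounded-unique-at {suc (suc m)} a pos bx by e (‵inj₁ v) =
    bounded-unique-at (init a) (λ k → pos (inject₁ k)) (Bounded-init a _ bx) (Bounded-init a _ by)
      (proj₂ (last-split a pos bx by e)) v

  bounded-unique : ∀ {m} (a : Fin m → ℕ) → (∀ i → 0 < a i) → ∀ {x y} → Bounded a x → Bounded a y →
    lincomb x a ≡ lincomb y a → ∀ i → x i ≡ y i
  bounded-unique a pos bx by e i = bounded-unique-at a pos bx by e (view i)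

  -- Existence, one generator at a time: reduce the last coefficient x_t
  -- modulo D_t and carry the excess q·D_t·a_t = q·lcm(a_j, a_t) over to the
  -- earlier generator a_j provided by (*).
  module Carry {m : ℕ} (a : Fin (suc (suc m)) → ℕ) (pos : ∀ i → 0 < a i) (st : CondStar a) (x : Fin (suc (suc m)) → ℕ) where

    private
      t : Fin (suc (suc m))
      t = fromℕ (suc m)
      star = st t (last-≥1 a pos)
      j = proj₁ star
      below = below-last j (subst (toℕ j <_) (toℕ-fromℕ (suc m)) (proj₁ (proj₂ star)))
      j′ = proj₁ below
      instance
        D≢0 : NonZero (D a t)
        D≢0 = >-nonZero (D-pos a pos t (last-≥1 a pos))
      q = x t / D a t
      r = x t % D a t
      w = _∣_.quotient (m∣lcm[m,n] (a j) (a t))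

    w*aj≡D*at : w * a j ≡ D a t * a t
    w*aj≡D*at = trans (sym (_∣_.equality (m∣lcm[m,n] (a j) (a t)))) (trans (sym (proj₂ (proj₂ star))) (D-spec a t))

    carried : Fin (suc m) → ℕ
    carried k = x (inject₁ k) + unit j′ (q * w) k

    extend : (∃ λ y′ → Bounded (init a) y′ × lincomb y′ (init a) ≡ lincomb carried (init a)) →
      ∃ λ y → Bounded a y × lincomb y a ≡ lincomb x a
    extend (y′ , bounded′ , value′) = snoc y′ r , bounded , value
      where
      bounded : Bounded a (snoc y′ r)
      bounded i = at (view i)
        where
        at : ∀ {i} → View i → 1 ≤ toℕ i → snoc y′ r i < D a i
        at ‵fromℕ             _   = subst (_< D a t) (sym (snoc-last y′ r)) (m%n<n (x t) (D a t))
        at (‵inj₁ {i = k} _) k≥1 = subst₂ _<_ (sym (snoc-init y′ r k)) (D-init a k)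
                                      (bounded′ k (subst (1 ≤_) (toℕ-inject₁ k) k≥1))

      value : lincomb (snoc y′ r) a ≡ lincomb x a
      value = begin
        lincomb (snoc y′ r) a
          ≡⟨ lincomb-last (snoc y′ r) a ⟩
        lincomb (init (snoc y′ r)) (init a) + snoc y′ r t * a t
          ≡⟨ cong₂ _+_ (lincomb-cong (init a) (snoc-init y′ r)) (cong (_* a t) (snoc-last y′ r)) ⟩
        lincomb y′ (init a) + r * a t
          ≡⟨ cong (_+ r * a t) value′ ⟩
        lincomb carried (init a) + r * a t
          ≡⟨ cong (_+ r * a t) (lincomb-+ (init a) (init x) (unit j′ (q * w))) ⟩
        lincomb (init x) (init a) + lincomb (unit j′ (q * w)) (init a) + r * a t
          ≡⟨ cong (λ z → lincomb (init x) (init a) + z + r * a t)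
                  (trans (lincomb-unit (init a) j′ (q * w)) (cong (λ z → q * w * a z) (proj₂ below))) ⟩
        lincomb (init x) (init a) + q * w * a j + r * a t
          ≡⟨ cong (λ z → lincomb (init x) (init a) + z + r * a t) (trans (*-assoc q w (a j)) (cong (q *_) w*aj≡D*at)) ⟩
        lincomb (init x) (init a) + q * (D a t * a t) + r * a t
          ≡⟨ regroup (lincomb (init x) (init a)) q (D a t) (a t) r ⟩
        lincomb (init x) (init a) + (r + q * D a t) * a t
          ≡⟨ cong (λ z → lincomb (init x) (init a) + z * a t) (sym (m≡m%n+[m/n]*n (x t) (D a t))) ⟩
        lincomb (init x) (init a) + x t * a t
          ≡⟨ sym (lincomb-last x a) ⟩
        lincomb x a ∎
        where
        open ≡-Reasoning
        regroup : ∀ L q D c r → L + q * (D * c) + r * c ≡ L + (r + q * D) * c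
        regroup = solve-∀

  bounded-exists : ∀ {m} (a : Fin m → ℕ) → (∀ i → 0 < a i) → CondStar a → ∀ x →
    ∃ λ y → Bounded a y × lincomb y a ≡ lincomb x a
  bounded-exists {zero}        a _   _  x = x , (λ ()) , refl
  bounded-exists {suc zero}    a _   _  x = x , (λ { F.zero () }) , refl
  bounded-exists {suc (suc m)} a pos st x =
    Carry.extend a pos st x (bounded-exists (init a) (λ k → pos (inject₁ k)) (CondStar-init a st) (Carry.carried a pos st x))

module Radix where

  open import Data.Nat using (ℕ; zero; suc; _+_; _*_; _^_; _<_; _≤_; _≟_; z≤n; s≤s; >-nonZero)
  open import Data.Nat.Properties
  open import Data.Nat.Tactic.RingSolver using (solve-∀)
  open import Data.Nat.Divisibility using (_∣_; _∣?_; divides)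
  open import Data.Nat.DivMod using (_/_; _%_; m≡m%n+[m/n]*n; m%n<n; [m+kn]%n≡m%n; m<n⇒m%n≡m; m<n*o⇒m/o<n)
  open import Data.List using ([]; _∷_)
  open import Data.Product using (_×_; _,_; proj₁; proj₂)
  open import Relation.Binary.PropositionalEquality
  open import Relation.Nullary using (yes; no; ¬_)
  open import Data.Empty using (⊥-elim)
  open Sums
  open Partitions using (δ; δ-same; δ-other)

  value : ℕ → ℕ → (ℕ → ℕ) → ℕ
  value d zero    c = 0
  value d (suc N) c = c 0 + d * value d N (λ j → c (suc j))

  value-cong : ∀ d N {c c′ : ℕ → ℕ} → (∀ j → c j ≡ c′ j) → value d N c ≡ value d N c′
  value-cong d zero    e = refl
  value-cong d (suc N) e = cong₂ _+_ (e 0) (cong (d *_) (value-cong d N (λ j → e (suc j))))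

  value-zero : ∀ d N → value d N (λ _ → 0) ≡ 0
  value-zero d zero    = refl
  value-zero d (suc N) = trans (cong (d *_) (value-zero d N)) (*-zeroʳ d)

  value-+ : ∀ d N (c c′ : ℕ → ℕ) → value d N (λ j → c j + c′ j) ≡ value d N c + value d N c′
  value-+ d zero    c c′ = refl
  value-+ d (suc N) c c′ rewrite value-+ d N (λ j → c (suc j)) (λ j → c′ (suc j)) = regroup (c 0) (c′ 0) d _ _
    where
    regroup : ∀ u v d x y → u + v + d * (x + y) ≡ u + d * x + (v + d * y)
    regroup = solve-∀

  value-Σl : ∀ {A : Set} d N (f : A → ℕ → ℕ) l →
    Σl (λ x → value d N (f x)) l ≡ value d N (λ j → Σl (λ x → f x j) l)
  value-Σl d N f []      = sym (value-zero d N)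
  value-Σl d N f (x ∷ l) =
    trans (cong (value d N (f x) +_) (value-Σl d N f l)) (sym (value-+ d N (f x) (λ j → Σl (λ x → f x j) l)))

  δ-suc : ∀ e j → δ (suc e) (suc j) ≡ δ e j
  δ-suc e j with e ≟ j
  ... | yes refl = trans (δ-same (suc e)) (sym (δ-same e))
  ... | no  e≢j  = trans (δ-other (λ se≡sj → e≢j (suc-injective se≡sj))) (sym (δ-other e≢j))

  value-δ : ∀ d N e → e < N → value d N (δ e) ≡ d ^ e
  value-δ d (suc N) zero    _ = begin
    δ 0 0 + d * value d N (λ j → δ 0 (suc j))
      ≡⟨ cong₂ (λ u v → u + d * v) (δ-same 0) (value-cong d N {c′ = λ _ → 0} (λ j → δ-other {0} {suc j} 0≢1+n)) ⟩
    1 + d * value d N (λ _ → 0)                 ≡⟨ cong (λ v → 1 + d * v) (value-zero d N) ⟩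
    1 + d * 0                                   ≡⟨ cong suc (*-zeroʳ d) ⟩
    1                                           ∎
    where open ≡-Reasoning
  value-δ d (suc N) (suc e) (s≤s e<N) = cong (d *_) (trans (value-cong d N (δ-suc e)) (value-δ d N e e<N))

  -- the j-th digit of y in base d (meaningful for d ≥ 2)
  digit : ℕ → ℕ → ℕ → ℕ
  digit zero    _       _ = 0
  digit (suc d) zero    y = y % suc d
  digit (suc d) (suc j) y = digit (suc d) j (y / suc d)

  digit-< : ∀ {d} j y → 1 ≤ d → digit d j y < d
  digit-< {suc d} zero    y _ = m%n<n y (suc d)
  digit-< {suc d} (suc j) y _ = digit-< j (y / suc d) (s≤s z≤n)

  digit-high : ∀ {d} j y → y < d ^ j → digit d j y ≡ 0
  digit-high {zero}  j       y _ = refl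
  digit-high {suc d} zero    zero    _ = refl
  digit-high {suc d} zero    (suc y) (s≤s ())
  digit-high {suc d} (suc j) y y<d^j =
    digit-high j (y / suc d) (m<n*o⇒m/o<n (subst (y <_) (*-comm (suc d) _) y<d^j))

  value-digits : ∀ {d} N y → 1 ≤ d → y < d ^ N → value d N (λ j → digit d j y) ≡ y
  value-digits {suc d} zero    zero    _ _ = refl
  value-digits {suc d} zero    (suc y) _ (s≤s ())
  value-digits {suc d} (suc N) y       _ y<d^N = begin
    y % suc d + suc d * value (suc d) N (λ j → digit (suc d) j (y / suc d))
      ≡⟨ cong (λ v → y % suc d + suc d * v)
              (value-digits N (y / suc d) (s≤s z≤n) (m<n*o⇒m/o<n (subst (y <_) (*-comm (suc d) _) y<d^N))) ⟩
    y % suc d + suc d * (y / suc d)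
      ≡⟨ cong (y % suc d +_) (*-comm (suc d) (y / suc d)) ⟩
    y % suc d + y / suc d * suc d
      ≡⟨ sym (m≡m%n+[m/n]*n y (suc d)) ⟩
    y ∎
    where open ≡-Reasoning

  value-injective : ∀ {d} N (c c′ : ℕ → ℕ) → (∀ j → c j < d) → (∀ j → c′ j < d) →
    value d N c ≡ value d N c′ → ∀ j → j < N → c j ≡ c′ j
  value-injective {zero}  (suc N) c c′ c<d _ _ _ _ with c<d 0
  ... | ()
  value-injective {suc d} (suc N) c c′ c<d c′<d e j j<N = at j j<N
    where
    X  = value (suc d) N (λ j → c (suc j))
    X′ = value (suc d) N (λ j → c′ (suc j))
    e′ : c 0 + X * suc d ≡ c′ 0 + X′ * suc d
    e′ = trans (cong (c 0 +_) (*-comm X (suc d))) (trans e (cong (c′ 0 +_) (*-comm (suc d) X′)))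
    first : c 0 ≡ c′ 0
    first = begin
      c 0                           ≡⟨ sym (m<n⇒m%n≡m (c<d 0)) ⟩
      c 0 % suc d                   ≡⟨ sym ([m+kn]%n≡m%n (c 0) X (suc d)) ⟩
      (c 0 + X * suc d) % suc d     ≡⟨ cong (_% suc d) e′ ⟩
      (c′ 0 + X′ * suc d) % suc d   ≡⟨ [m+kn]%n≡m%n (c′ 0) X′ (suc d) ⟩
      c′ 0 % suc d                  ≡⟨ m<n⇒m%n≡m (c′<d 0) ⟩
      c′ 0                          ∎
      where open ≡-Reasoning
    rest : X ≡ X′
    rest = *-cancelʳ-≡ X X′ (suc d) (+-cancelˡ-≡ (c 0) _ _ (trans e′ (cong (_+ X′ * suc d) (sym first))))
    at : ∀ j → j < suc N → c j ≡ c′ j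
    at zero    _         = first
    at (suc j) (s≤s j<N) =
      value-injective N (λ j → c (suc j)) (λ j → c′ (suc j)) (λ j → c<d (suc j)) (λ j → c′<d (suc j)) rest j j<N

  e<d^e : ∀ {d} e → 2 ≤ d → e < d ^ e
  e<d^e zero    _   = s≤s z≤n
  e<d^e {d} (suc e) d≥2 = begin-strict
    suc e          <⟨ s≤s (e<d^e e d≥2) ⟩
    suc (d ^ e)    ≤⟨ +-monoˡ-≤ (d ^ e) (d^e≥1) ⟩
    d ^ e + d ^ e  ≡⟨ cong (d ^ e +_) (sym (+-identityʳ (d ^ e))) ⟩
    2 * d ^ e      ≤⟨ *-monoˡ-≤ (d ^ e) d≥2 ⟩
    d * d ^ e      ∎
    where
    open ≤-Reasoning
    d^e≥1 : 1 ≤ d ^ e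
    d^e≥1 = ≤-trans (m^n>0 2 e) (^-monoˡ-≤ e d≥2)

  IsFactorisation : ℕ → ℕ → ℕ × ℕ → Set
  IsFactorisation d k ue = proj₁ ue * d ^ proj₂ ue ≡ k × ¬ d ∣ proj₁ ue × 1 ≤ proj₁ ue

  -- strip factors d off k, with fuel f ≥ k
  factorWith : ℕ → ℕ → ℕ → ℕ × ℕ
  factorWith zero    d k = k , 0
  factorWith (suc f) d k with d ∣? k
  ... | yes (divides q _) = proj₁ (factorWith f d q) , suc (proj₂ (factorWith f d q))
  ... | no  _             = k , 0

  factor : ℕ → ℕ → ℕ × ℕ
  factor d k = factorWith k d k

  factorWith-spec : ∀ f {d k} → 2 ≤ d → 1 ≤ k → k ≤ f → IsFactorisation d k (factorWith f d k)
  factorWith-spec zero    d≥2 k≥1 k≤0 = ⊥-elim (<-irrefl refl (≤-trans k≥1 k≤0))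
  factorWith-spec (suc f) {d} {k} d≥2 k≥1 k≤f with d ∣? k
  ... | no  d∤k = *-identityʳ k , d∤k , k≥1
  ... | yes (divides q k≡q*d) =
    trans (regroup u d (d ^ e)) (trans (cong (_* d) u*d^e≡q) (sym k≡q*d)) , d∤u , u≥1
    where
    q≥1 : 1 ≤ q
    q≥1 = n≢0⇒n>0 λ { refl → <-irrefl (sym k≡q*d) k≥1 }
    q<k : q < k
    q<k = subst (q <_) (sym k≡q*d) (m<m*n q d d≥2)
      where instance _ = >-nonZero q≥1
    IH = factorWith-spec f d≥2 q≥1 (≤-pred (≤-trans q<k k≤f))
    u = proj₁ (factorWith f d q)
    e = proj₂ (factorWith f d q)
    u*d^e≡q = proj₁ IH
    d∤u = proj₁ (proj₂ IH)
    u≥1 = proj₂ (proj₂ IH)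
    regroup : ∀ u d x → u * (d * x) ≡ u * x * d
    regroup = solve-∀

  factorWith-unique : ∀ f {d u} e → 2 ≤ d → ¬ d ∣ u → 1 ≤ u → u * d ^ e ≤ f → factorWith f d (u * d ^ e) ≡ (u , e)
  factorWith-unique zero    {d} {u} e d≥2 d∤u u≥1 le = ⊥-elim (<-irrefl refl (≤-trans (*-mono-≤ u≥1 (m^n>0 d e)) le))
    where instance _ = >-nonZero (≤-trans (s≤s z≤n) d≥2)
  factorWith-unique (suc f) {d} {u} zero    d≥2 d∤u u≥1 le with d ∣? (u * 1)
  ... | yes d∣u = ⊥-elim (d∤u (subst (d ∣_) (*-identityʳ u) d∣u))
  ... | no  _   = cong (_, 0) (*-identityʳ u)
  factorWith-unique (suc f) {d} {u} (suc e) d≥2 d∤u u≥1 le with d ∣? (u * d ^ suc e)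
  ... | no  d∤k = ⊥-elim (d∤k (divides (u * d ^ e) (regroup u d (d ^ e))))
    where
    regroup : ∀ u d x → u * (d * x) ≡ u * x * d
    regroup = solve-∀
  ... | yes (divides q k≡q*d) = cong (λ ue → proj₁ ue , suc (proj₂ ue)) (trans (cong (factorWith f d) q≡) IH)
    where
    instance _ = >-nonZero (≤-trans (s≤s z≤n) d≥2)
    regroup : ∀ u d x → u * (d * x) ≡ u * x * d
    regroup = solve-∀
    q≡ : q ≡ u * d ^ e
    q≡ = *-cancelʳ-≡ q (u * d ^ e) d (trans (sym k≡q*d) (regroup u d (d ^ e)))
    IH : factorWith f d (u * d ^ e) ≡ (u , e)
    IH = factorWith-unique f e d≥2 d∤u u≥1 (≤-pred (≤-trans k<k′ le))
      where
      k<k′ : u * d ^ e < u * d ^ suc e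
      k<k′ = subst (u * d ^ e <_) (sym (regroup u d (d ^ e)))
               (m<m*n (u * d ^ e) d {{>-nonZero (*-mono-≤ u≥1 (m^n>0 d e))}} d≥2)

  factor-spec : ∀ {d k} → 2 ≤ d → 1 ≤ k → IsFactorisation d k (factor d k)
  factor-spec {k = k} d≥2 k≥1 = factorWith-spec k d≥2 k≥1 ≤-refl

  factor-unique : ∀ {d u} e → 2 ≤ d → ¬ d ∣ u → 1 ≤ u → factor d (u * d ^ e) ≡ (u , e)
  factor-unique {d} {u} e d≥2 d∤u u≥1 = factorWith-unique (u * d ^ e) e d≥2 d∤u u≥1 ≤-refl

-- A block is a pair (k, i) with k ≥ 1, of weight k·a_i.  A valid family is a
-- multiset of blocks of total weight n in which, for every i ≥ 1, each block
-- (k, i) occurs fewer than D_i times.  Assuming (*), valid families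
-- correspond bijectively
--  * to (ii), letting block (k, i) contribute a_i to the multiplicity of the
--    part k: the multiplicity Σ_i c(k,i)·a_i of k then comes with a bounded
--    representation, which exists and is unique;
--  * to (iii), by Glaisher's construction: block (k, i) becomes the part k·a_0
--    if i = 0, and otherwise, writing k = u·D_i^e with D_i ∤ u, D_i^e parts
--    u·a_i.  The parts u·a_i with D_i ∤ u are exactly those for which i is the
--    least index of a generator dividing them, and the multiplicity of u·a_i is
--    read off in base D_i.
module Blocks {m : ℕ} (a : Fin m → ℕ) (pos : ∀ i → 0 < a i) (st : CondStar a) (n : ℕ) where

  open import Data.Nat using (ℕ; zero; suc; _*_; _^_; _<_; _≤_; _≟_; _≤?_; z≤n; s≤s; >-nonZero)
  open import Data.Nat.Properties
  open import Data.Nat.Divisibility using (_∣_; _∣?_; divides; ∣-trans; n∣m*n; *-cancelʳ-∣; *-monoˡ-∣)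
  open import Data.Nat.LCM using (m∣lcm[m,n]; lcm-least)
  open import Data.List using (List; []; _∷_; [_]; concatMap; replicate; applyUpTo; allFin; cartesianProduct)
  open import Data.Nat.ListAction using (sum)
  open import Data.List.Membership.Propositional using (_∈_; _∉_)
  open import Data.List.Membership.Propositional.Properties using (∈-cartesianProduct⁺; ∈-cartesianProduct⁻; ∈-applyUpTo⁺; ∈-applyUpTo⁻; ∈-allFin)
  open import Data.List.Relation.Unary.Any using (here; there)
  open import Data.List.Relation.Unary.All using (All; []; _∷_)
  import Data.List.Relation.Unary.All as All
  open import Data.List.Relation.Unary.Unique.Propositional using (Unique)
  open import Data.List.Relation.Unary.Unique.Propositional.Properties using (cartesianProduct⁺; applyUpTo⁺₁; allFin⁺)
  open import Data.Fin using (Fin; toℕ)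
  import Data.Fin as F
  import Data.Fin.Properties as FP
  open import Data.Product using (Σ; ∃; _×_; _,_; proj₁; proj₂)
  open import Data.Product.Properties using (≡-dec)
  open import Data.Sum using (_⊎_; inj₁; inj₂)
  open import Relation.Binary.PropositionalEquality hiding ([_])
  open import Relation.Binary.Bundles using (Setoid)
  open import Relation.Nullary using (Dec; yes; no; ¬_)
  open import Data.Empty using (⊥-elim)
  open import Level using (0ℓ)
  open import Relation.Binary.Definitions using (tri<; tri≈; tri>)
  open import Function.Bundles using (Bijection)
  open Sums
  open Partitions
  open LinearForms
  open BoundedRepresentations using (Bounded; D-spec; D-pos; bounded-unique; bounded-exists)
  open Radix
  open Bijections
  open Conjugation using (CondII⇒count-S)

  Block : Set
  Block = ℕ × Fin m

  _≟ᵇ_ : DecidableEquality Block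
  _≟ᵇ_ = ≡-dec _≟_ F._≟_

  module B = Multiset _≟ᵇ_

  weight : Block → ℕ
  weight (k , i) = k * a i

  D : Fin m → ℕ
  D = BoundedRepresentations.D a

  Valid : List Block → Set
  Valid l = All (λ b → 1 ≤ proj₁ b) l × Σl weight l ≡ n × (∀ k i → 1 ≤ toℕ i → B.count (k , i) l < D i)

  Families : Setoid 0ℓ 0ℓ
  Families = record
    { Carrier       = Σ (List Block) Valid
    ; _≈_           = λ x y → proj₁ x B.≋ proj₁ y
    ; isEquivalence = record { refl = λ _ → refl ; sym = λ e p → sym (e p) ; trans = λ e₁ e₂ p → trans (e₁ p) (e₂ p) }
    }

  Admissible : Block → Set
  Admissible (k , i) = 1 ≤ k × k ≤ n × (1 ≤ toℕ i → 2 ≤ D i)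

  valid⇒admissible : ∀ {l} → Valid l → All Admissible l
  valid⇒admissible {l} (k≥1 , Σ≡n , bounded) = All.tabulate admissible
    where
    admissible : ∀ {b} → b ∈ l → Admissible b
    admissible {k , i} b∈ =
      All.lookup k≥1 b∈ ,
      ≤-trans (m≤m*n k (a i) {{>-nonZero (pos i)}}) (subst (k * a i ≤_) Σ≡n (Σl-∈-≤ b∈)) ,
      λ i≥1 → <-≤-trans (s≤s (B.∈⇒count>0 b∈)) (bounded k i i≥1)
      where
      Σl-∈-≤ : ∀ {b l} → b ∈ l → weight b ≤ Σl weight l
      Σl-∈-≤ {l = b ∷ l} (here refl) = m≤m+n (weight b) (Σl weight l)
      Σl-∈-≤ {l = c ∷ l} (there b∈)  = ≤-trans (Σl-∈-≤ b∈) (m≤n+m (Σl weight l) (weight c))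

  count-outside : ∀ {l} → All Admissible l → ∀ {k} i → ¬ (1 ≤ k × k ≤ n) → B.count (k , i) l ≡ 0
  count-outside adm i out = B.∉⇒count≡0 (λ b∈ → let (k≥1 , k≤n , _) = All.lookup adm b∈ in out (k≥1 , k≤n))

  inRange : List Block
  inRange = cartesianProduct (applyUpTo suc n) (allFin m)

  ∈-inRange : ∀ {k} i → 1 ≤ k → k ≤ n → (k , i) ∈ inRange
  ∈-inRange {suc k} i _ k<n = ∈-cartesianProduct⁺ (∈-applyUpTo⁺ suc k<n) (∈-allFin i)

  inRange-unique : Unique inRange
  inRange-unique = cartesianProduct⁺ (applyUpTo⁺₁ suc n (λ i<j _ → <⇒≢ (s≤s i<j))) (allFin⁺ m)

  family : (Block → ℕ) → List Block
  family c = concatMap (λ b → replicate (c b) b) inRange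

  count-family-in : ∀ c {k} i → 1 ≤ k → k ≤ n → B.count (k , i) (family c) ≡ c (k , i)
  count-family-in c {k} i k≥1 k≤n =
    trans (B.count-expand c (k , i) inRange)
          (trans (cong (c (k , i) *_) (B.Unique⇒count≡1 inRange-unique (∈-inRange i k≥1 k≤n))) (*-identityʳ _))

  count-family-out : ∀ c {k} i → ¬ (1 ≤ k × k ≤ n) → B.count (k , i) (family c) ≡ 0
  count-family-out c {k} i out =
    trans (B.count-expand c (k , i) inRange) (trans (cong (c (k , i) *_) (B.∉⇒count≡0 not-in)) (*-zeroʳ (c (k , i))))
    where
    not-in : (k , i) ∉ inRange
    not-in b∈ with ∈-cartesianProduct⁻ (applyUpTo suc n) (allFin m) b∈
    ... | k∈ , _ with ∈-applyUpTo⁻ suc k∈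
    ... | j , j<n , refl = out (s≤s z≤n , j<n)

  family-in-range : ∀ c {b} → b ∈ family c → 1 ≤ proj₁ b × proj₁ b ≤ n
  family-in-range c {k , i} b∈ with 1 ≤? k | k ≤? n
  ... | yes k≥1 | yes k≤n = k≥1 , k≤n
  ... | no  k≱1 | _       = ⊥-elim (<-irrefl (sym (count-family-out c i (λ r → k≱1 (proj₁ r)))) (B.∈⇒count>0 b∈))
  ... | yes _   | no  k≰n = ⊥-elim (<-irrefl (sym (count-family-out c i (λ r → k≰n (proj₂ r)))) (B.∈⇒count>0 b∈))

  count-partition-outside : ∀ {μ k} → IsPartition n μ → ¬ (1 ≤ k × k ≤ n) → count k μ ≡ 0
  count-partition-outside {μ} (_ , pos-μ , Σ≡n) out =
    ∉⇒count≡0 (λ k∈ → out (All.lookup pos-μ k∈ , subst (_ ≤_) Σ≡n (∈⇒≤sum μ k∈)))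

  image : (Block → List ℕ) → List Block → List ℕ
  image φ l = sort (concatMap φ l)

  image-resp-≋ : ∀ φ {l₁ l₂} → l₁ B.≋ l₂ → image φ l₁ ≡ image φ l₂
  image-resp-≋ φ {l₁} {l₂} e = sort-canonical (concatMap φ l₁) (image φ l₂) (sort-sorted (concatMap φ l₂)) λ p → begin
    count p (concatMap φ l₁)         ≡⟨ count-concatMap φ p l₁ ⟩
    Σl (λ b → count p (φ b)) l₁      ≡⟨ B.≋⇒Σl (λ b → count p (φ b)) l₁ l₂ e ⟩
    Σl (λ b → count p (φ b)) l₂      ≡⟨ sym (count-concatMap φ p l₂) ⟩
    count p (concatMap φ l₂)         ≡⟨ sym (count-sort p (concatMap φ l₂)) ⟩
    count p (image φ l₂)             ∎
    where open ≡-Reasoning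

  image-counts : ∀ φ {l₁ l₂} → image φ l₁ ≡ image φ l₂ →
    ∀ t → count t (concatMap φ l₁) ≡ count t (concatMap φ l₂)
  image-counts φ {l₁} {l₂} e t =
    trans (sym (count-sort t (concatMap φ l₁))) (trans (cong (count t) e) (count-sort t (concatMap φ l₂)))

  bijection-from-families : (Q : List ℕ → Set) (φ : Block → List ℕ) →
    (∀ l → Valid l → IsPartition n (image φ l) × Q (image φ l)) →
    (∀ l₁ l₂ → Valid l₁ → Valid l₂ → image φ l₁ ≡ image φ l₂ → l₁ B.≋ l₂) →
    (∀ μ → IsPartition n μ × Q μ → ∃ λ l → Valid l × image φ l ≡ μ) →
    Bijection Families (Parts n Q)
  bijection-from-families Q φ valid injective onto =
    bijection-onto Families n Q (λ x → image φ (proj₁ x)) (λ x → valid (proj₁ x) (proj₂ x))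
      (λ {x} {y} → image-resp-≋ φ {proj₁ x} {proj₁ y})
      (λ {x} {y} → injective (proj₁ x) (proj₁ y) (proj₂ x) (proj₂ y))
      (λ μ μ-valid → let (l , l-valid , image≡μ) = onto μ μ-valid in (l , l-valid) , image≡μ)

  expandII : Block → List ℕ
  expandII (k , i) = replicate (a i) k

  count-expandII-block : ∀ p b → count p (expandII b) ≡ lincomb (λ i → B.δ b (p , i)) a
  count-expandII-block p (k , i) = by-cases (k ≟ p)
    where
    by-cases : Dec (k ≡ p) → count p (replicate (a i) k) ≡ lincomb (λ i′ → B.δ (k , i) (p , i′)) a
    by-cases (yes refl) =
      trans (count-replicate-same k (a i))
            (sym (trans (lincomb-cong a δ≡unit) (trans (lincomb-unit a i 1) (*-identityˡ (a i)))))
      where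
      δ≡unit : ∀ i′ → B.δ (k , i) (k , i′) ≡ unit i 1 i′
      δ≡unit i′ with i′ F.≟ i
      ... | yes refl  = B.δ-same (k , i)
      ... | no  i′≢i  = B.δ-other {k , i} {k , i′} (λ e → i′≢i (sym (cong proj₂ e)))
    by-cases (no k≢p) =
      trans (count-replicate-other (a i) k≢p)
            (sym (trans (lincomb-cong a (λ i′ → B.δ-other {k , i} {p , i′} (λ e → k≢p (cong proj₁ e)))) (lincomb-zero a)))

  count-expandII : ∀ p l → count p (concatMap expandII l) ≡ lincomb (λ i → B.count (p , i) l) a
  count-expandII p l = begin
    count p (concatMap expandII l)                 ≡⟨ count-concatMap expandII p l ⟩
    Σl (λ b → count p (expandII b)) l              ≡⟨ Σl-cong l (λ b _ → count-expandII-block p b) ⟩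
    Σl (λ b → lincomb (λ i → B.δ b (p , i)) a) l   ≡⟨ lincomb-Σl a (λ b i → B.δ b (p , i)) l ⟩
    lincomb (λ i → Σl (λ b → B.δ b (p , i)) l) a   ≡⟨ lincomb-cong a (λ i → B.Σl-δ (p , i) l) ⟩
    lincomb (λ i → B.count (p , i) l) a            ∎
    where open ≡-Reasoning

  sum-expandII : ∀ l → sum (concatMap expandII l) ≡ Σl weight l
  sum-expandII l = trans (sum-concatMap expandII l)
    (Σl-cong l (λ { (k , i) _ → trans (sum-replicate (a i) k) (*-comm (a i) k) }))

  toII-valid : ∀ l → Valid l → IsPartition n (image expandII l) × CondII a (image expandII l)
  toII-valid l (k≥1 , Σ≡n , _) =
    ( sort-sorted (concatMap expandII l)
    , All.tabulate parts-pos
    , trans (sum-sort (concatMap expandII l)) (trans (sum-expandII l) Σ≡n) )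
    , λ p _ → (λ i → B.count (p , i) l) , sym (trans (count-sort p (concatMap expandII l)) (count-expandII p l))
    where
    parts-pos : ∀ {p} → p ∈ image expandII l → 0 < p
    parts-pos p∈ with ∈-concatMap expandII l (∈-sort⁻ (concatMap expandII l) p∈)
    ... | (k , i) , b∈ , p∈rep = subst (0 <_) (sym (∈-replicate (a i) p∈rep)) (All.lookup k≥1 b∈)

  -- the multiplicity of k determines the bounded representation (c(k,i))_i
  toII-injective : ∀ l₁ l₂ → Valid l₁ → Valid l₂ → image expandII l₁ ≡ image expandII l₂ → l₁ B.≋ l₂
  toII-injective l₁ l₂ (_ , _ , bounded₁) (_ , _ , bounded₂) e (k , i) =
    bounded-unique a pos (bounded₁ k) (bounded₂ k)
      (trans (sym (count-expandII k l₁)) (trans (image-counts expandII {l₁} {l₂} e k) (count-expandII k l₂))) i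

  -- conversely, take the bounded representation of each multiplicity
  toII-onto : ∀ μ → IsPartition n μ × CondII a μ → ∃ λ l → Valid l × image expandII l ≡ μ
  toII-onto μ (μ-part@(s , _ , Σ≡n) , cII) =
    L , (All.tabulate (λ b∈ → proj₁ (family-in-range c b∈)) , ΣL≡n , bounded) , image≡μ
    where
    rep : ∀ k → ∃ λ y → Bounded a y × lincomb y a ≡ count k μ
    rep k with CondII⇒count-S a μ cII k
    ... | x , x↦ with bounded-exists a pos st x
    ... | y , by , y↦ = y , by , trans y↦ x↦
    c : Block → ℕ
    c (k , i) = proj₁ (rep k) i
    L = family c
    counts : ∀ k → lincomb (λ i → B.count (k , i) L) a ≡ count k μ
    counts k with 1 ≤? k | k ≤? n
    ... | yes k≥1 | yes k≤n = trans (lincomb-cong a (λ i → count-family-in c i k≥1 k≤n)) (proj₂ (proj₂ (rep k)))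
    ... | no  k≱1 | _       = outside (λ r → k≱1 (proj₁ r))
      where
      outside : ¬ (1 ≤ k × k ≤ n) → lincomb (λ i → B.count (k , i) L) a ≡ count k μ
      outside out = trans (trans (lincomb-cong a (λ i → count-family-out c i out)) (lincomb-zero a))
                          (sym (count-partition-outside μ-part out))
    ... | yes _   | no  k≰n = trans (trans (lincomb-cong a (λ i → count-family-out c i out)) (lincomb-zero a))
                                    (sym (count-partition-outside μ-part out))
      where
      out : ¬ (1 ≤ k × k ≤ n)
      out r = k≰n (proj₂ r)
    image≡μ : image expandII L ≡ μ
    image≡μ = sort-canonical (concatMap expandII L) μ s (λ k → trans (count-expandII k L) (counts k))
    ΣL≡n : Σl weight L ≡ n
    ΣL≡n = trans (sym (sum-expandII L)) (trans (sym (sum-sort (concatMap expandII L))) (trans (cong sum image≡μ) Σ≡n))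
    bounded : ∀ k i → 1 ≤ toℕ i → B.count (k , i) L < D i
    bounded k i i≥1 with 1 ≤? k | k ≤? n
    ... | yes k≥1 | yes k≤n = subst (_< D i) (sym (count-family-in c i k≥1 k≤n)) (proj₁ (proj₂ (rep k)) i i≥1)
    ... | no  k≱1 | _       = subst (_< D i) (sym (count-family-out c i (λ r → k≱1 (proj₁ r)))) (D-pos a pos i i≥1)
    ... | yes _   | no  k≰n = subst (_< D i) (sym (count-family-out c i (λ r → k≰n (proj₂ r)))) (D-pos a pos i i≥1)

  bijection-families-II : Bijection Families (Parts n (CondII a))
  bijection-families-II = bijection-from-families (CondII a) expandII toII-valid toII-injective toII-onto

  Least : Fin m → ℕ → Set
  Least i t = a i ∣ t × (∀ j → toℕ j < toℕ i → ¬ a j ∣ t)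

  Least-unique : ∀ {i i′ t} → Least i t → Least i′ t → i ≡ i′
  Least-unique {i} {i′} (a∣t , below) (a′∣t , below′) with <-cmp (toℕ i) (toℕ i′)
  ... | tri< i<i′ _ _ = ⊥-elim (below′ i i<i′ a∣t)
  ... | tri≈ _ i≡i′ _ = FP.toℕ-injective i≡i′
  ... | tri> _ _ i′<i = ⊥-elim (below i′ i′<i a′∣t)

  least : ∀ {k} (P : Fin k → Set) → (∀ i → Dec (P i)) → ∃ P → ∃ λ i → P i × (∀ j → toℕ j < toℕ i → ¬ P j)
  least {suc k} P P? (i , Pi) with P? F.zero
  ... | yes P0 = F.zero , P0 , λ j ()
  least {suc k} P P? (F.zero  , P0) | no ¬P0 = ⊥-elim (¬P0 P0)
  least {suc k} P P? (F.suc i , Pi) | no ¬P0 with least (λ j → P (F.suc j)) (λ j → P? (F.suc j)) (i , Pi)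
  ... | i′ , Pi′ , below = F.suc i′ , Pi′ , λ { F.zero _ → ¬P0 ; (F.suc j) (s≤s j<i′) → below j j<i′ }

  Least-first : ∀ {i} u → toℕ i ≡ 0 → Least i (u * a i)
  Least-first u i≡0 = n∣m*n u , λ j j<i → ⊥-elim (<-irrefl refl (<-≤-trans (subst (_ <_) i≡0 j<i) z≤n))

  Least-later : ∀ {i} u → 1 ≤ toℕ i → ¬ D i ∣ u → Least i (u * a i)
  Least-later {i} u i≥1 D∤u = n∣m*n u , λ j j<i aj∣uai → D∤u (*-cancelʳ-∣ (a i) {{>-nonZero (pos i)}}
    (subst (_∣ u * a i) (D-spec a i)
      (lcm-least (∣-trans (BoundedRepresentations.gcdFirst-∣ a (toℕ i) j j<i) aj∣uai) (n∣m*n u))))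

  -- conversely, by (*): if D_i ∣ u then lcm(a_j, a_i) = lcm(g_i, a_i) = D_i·a_i divides u·a_i for some j < i
  Least⇒∤ : ∀ {i} u → 1 ≤ toℕ i → Least i (u * a i) → ¬ D i ∣ u
  Least⇒∤ {i} u i≥1 (_ , below) D∣u with st i i≥1
  ... | j , j<i , lcm-eq = below j j<i
    (∣-trans (subst (a j ∣_) (trans (sym lcm-eq) (D-spec a i)) (m∣lcm[m,n] (a j) (a i))) (*-monoˡ-∣ (a i) D∣u))

  -- Glaisher's map on blocks: glaisher k i (toℕ i) D_i.  Position and base
  -- are passed as arguments so that case analysis on the position leaves D_i intact.
  glaisher : ℕ → Fin m → ℕ → ℕ → List ℕ
  glaisher k i zero    d = [ k * a i ]
  glaisher k i (suc _) d = replicate (d ^ proj₂ (factor d k)) (proj₁ (factor d k) * a i)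

  expandIII : Block → List ℕ
  expandIII (k , i) = glaisher k i (toℕ i) (D i)

  position : ∀ (i : Fin m) → toℕ i ≡ 0 ⊎ 1 ≤ toℕ i
  position i with toℕ i
  ... | zero  = inj₁ refl
  ... | suc _ = inj₂ (s≤s z≤n)

  expandIII-first : ∀ k {i} → toℕ i ≡ 0 → expandIII (k , i) ≡ [ k * a i ]
  expandIII-first k i≡0 rewrite i≡0 = refl

  expandIII-later : ∀ k {i} → 1 ≤ toℕ i →
    expandIII (k , i) ≡ replicate (D i ^ proj₂ (factor (D i) k)) (proj₁ (factor (D i) k) * a i)
  expandIII-later k {i} i≥1 with toℕ i | i≥1
  ... | suc _ | _ = refl

  expandIII-parts : ∀ {k i t} → Admissible (k , i) → t ∈ expandIII (k , i) → 1 ≤ t × Least i t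
  expandIII-parts {k} {i} {t} (k≥1 , _ , D≥2) t∈ with position i
  ... | inj₁ i≡0 with ∈-replicate 1 (subst (t ∈_) (expandIII-first k {i} i≡0) t∈)
  ...   | refl = *-mono-≤ k≥1 (pos i) , Least-first k i≡0
  expandIII-parts {k} {i} {t} (k≥1 , _ , D≥2) t∈ | inj₂ i≥1 with ∈-replicate _ (subst (t ∈_) (expandIII-later k {i} i≥1) t∈)
  ...   | refl = let (_ , D∤u , u≥1) = factor-spec (D≥2 i≥1) k≥1 in *-mono-≤ u≥1 (pos i) , Least-later _ i≥1 D∤u

  sum-expandIII : ∀ {k i} → Admissible (k , i) → sum (expandIII (k , i)) ≡ k * a i
  sum-expandIII {k} {i} (k≥1 , _ , D≥2) with position i
  ... | inj₁ i≡0 rewrite expandIII-first k {i} i≡0 = +-identityʳ (k * a i)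
  ... | inj₂ i≥1 rewrite expandIII-later k {i} i≥1 =
    let (u , e) = factor (D i) k ; (u*D^e≡k , _ , _) = factor-spec (D≥2 i≥1) k≥1
    in trans (sum-replicate (D i ^ e) (u * a i)) (trans (regroup (D i ^ e) u (a i)) (cong (_* a i) u*D^e≡k))
    where
    regroup : ∀ x u c → x * (u * c) ≡ u * x * c
    regroup x u c = trans (sym (*-assoc x u c)) (cong (_* c) (*-comm x u))

  -- e < D^e ≤ u·D^e, so exponents of admissible blocks are ≤ n
  exponent-bound : ∀ {d u e} → 2 ≤ d → 1 ≤ u → u * d ^ e ≤ n → e < suc n
  exponent-bound {d} {u} {e} d≥2 u≥1 le =
    s≤s (≤-trans (<⇒≤ (e<d^e e d≥2)) (≤-trans (m≤n*m (d ^ e) u {{>-nonZero u≥1}}) le))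

  factor-of : ∀ {d k u e} → 2 ≤ d → ¬ d ∣ u → 1 ≤ u → k ≡ u * d ^ e → factor d k ≡ (u , e)
  factor-of {e = e} d≥2 d∤u u≥1 refl = factor-unique e d≥2 d∤u u≥1

  count-expandIII-first : ∀ {i₀} u {b} → toℕ i₀ ≡ 0 → Admissible b → count (u * a i₀) (expandIII b) ≡ B.δ b (u , i₀)
  count-expandIII-first {i₀} u {k , i} i₀≡0 adm = by-cases ((k , i) ≟ᵇ (u , i₀))
    where
    by-cases : Dec ((k , i) ≡ (u , i₀)) → count (u * a i₀) (expandIII (k , i)) ≡ B.δ (k , i) (u , i₀)
    by-cases (yes refl) = trans (cong (count (u * a i₀)) (expandIII-first u i₀≡0))
                                (trans (count-here (u * a i₀) []) (sym (B.δ-same (u , i₀))))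
    by-cases (no b≢)    = trans (∉⇒count≡0 not-in) (sym (B.δ-other b≢))
      where
      not-in : u * a i₀ ∉ expandIII (k , i)
      not-in t∈ with Least-unique (proj₂ (expandIII-parts adm t∈)) (Least-first u i₀≡0)
      ... | refl = b≢ (cong (_, i) (sym (*-cancelʳ-≡ u k (a i) {{>-nonZero (pos i)}}
                     (∈-replicate 1 (subst (u * a i ∈_) (expandIII-first k i₀≡0) t∈)))))

  count-expandIII-same : ∀ {i u} k → 1 ≤ toℕ i → ¬ D i ∣ u → 1 ≤ u → Admissible (k , i) →
    count (u * a i) (expandIII (k , i)) ≡ value (D i) (suc n) (λ e → B.δ (k , i) (u * D i ^ e , i))
  count-expandIII-same {i} {u} k i≥1 D∤u u≥1 (k≥1 , k≤n , D≥2) = by-cofactor (u′ ≟ u)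
    where
    d = D i
    d≥2 = D≥2 i≥1
    u′ = proj₁ (factor d k)
    e′ = proj₂ (factor d k)
    u′*d^e′≡k : u′ * d ^ e′ ≡ k
    u′*d^e′≡k = proj₁ (factor-spec d≥2 k≥1)
    image≡ : expandIII (k , i) ≡ replicate (d ^ e′) (u′ * a i)
    image≡ = expandIII-later k i≥1
    block⇒factor : ∀ {e} → (k , i) ≡ (u * d ^ e , i) → factor d k ≡ (u , e)
    block⇒factor eq = factor-of d≥2 D∤u u≥1 (cong proj₁ eq)

    by-cofactor : Dec (u′ ≡ u) → count (u * a i) (expandIII (k , i)) ≡ value d (suc n) (λ e → B.δ (k , i) (u * d ^ e , i))
    by-cofactor (no u′≢u) =
      trans (cong (count (u * a i)) image≡)
        (trans (count-replicate-other (d ^ e′) (λ eq → u′≢u (*-cancelʳ-≡ u′ u (a i) {{>-nonZero (pos i)}} eq)))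
               (sym (trans (value-cong d (suc n) (λ e → B.δ-other (λ eq → u′≢u (cong proj₁ (block⇒factor {e} eq)))))
                           (value-zero d (suc n)))))
    by-cofactor (yes u′≡u) = begin
      count (u * a i) (expandIII (k , i))               ≡⟨ cong (count (u * a i)) image≡ ⟩
      count (u * a i) (replicate (d ^ e′) (u′ * a i))   ≡⟨ cong (λ v → count (u * a i) (replicate (d ^ e′) (v * a i))) u′≡u ⟩
      count (u * a i) (replicate (d ^ e′) (u * a i))    ≡⟨ count-replicate-same (u * a i) (d ^ e′) ⟩
      d ^ e′                                            ≡⟨ sym (value-δ d (suc n) e′ e′≤n) ⟩
      value d (suc n) (δ e′)                            ≡⟨ value-cong d (suc n) (λ e → sym (indicator e (e′ ≟ e))) ⟩
      value d (suc n) (λ e → B.δ (k , i) (u * d ^ e , i)) ∎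
      where
      open ≡-Reasoning
      k≡ : k ≡ u * d ^ e′
      k≡ = trans (sym u′*d^e′≡k) (cong (_* d ^ e′) u′≡u)
      e′≤n : e′ < suc n
      e′≤n = exponent-bound d≥2 u≥1 (subst (_≤ n) k≡ k≤n)
      indicator : ∀ e → Dec (e′ ≡ e) → B.δ (k , i) (u * d ^ e , i) ≡ δ e′ e
      indicator e (yes refl) = trans (cong (λ k′ → B.δ (k′ , i) (u * d ^ e′ , i)) k≡) (trans (B.δ-same (u * d ^ e′ , i)) (sym (δ-same e′)))
      indicator e (no e′≢e)  = trans (B.δ-other (λ eq → e′≢e (cong proj₂ (block⇒factor {e} eq)))) (sym (δ-other e′≢e))

  -- … and for i ≢ i₀ the images of the blocks (k, i) avoid u·a_{i₀}, whose least generator is i₀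
  count-expandIII-later : ∀ {i₀ u} b → 1 ≤ toℕ i₀ → ¬ D i₀ ∣ u → 1 ≤ u → Admissible b →
    count (u * a i₀) (expandIII b) ≡ value (D i₀) (suc n) (λ e → B.δ b (u * D i₀ ^ e , i₀))
  count-expandIII-later {i₀} {u} (k , i) i₀≥1 D∤u u≥1 adm = by-index (i F.≟ i₀)
    where
    by-index : Dec (i ≡ i₀) → count (u * a i₀) (expandIII (k , i)) ≡ value (D i₀) (suc n) (λ e → B.δ (k , i) (u * D i₀ ^ e , i₀))
    by-index (yes refl) = count-expandIII-same k i₀≥1 D∤u u≥1 adm
    by-index (no i≢i₀)  = trans (∉⇒count≡0 not-in)
      (sym (trans (value-cong (D i₀) (suc n) (λ e → B.δ-other {k , i} {u * D i₀ ^ e , i₀} (λ eq → i≢i₀ (cong proj₂ eq)))) (value-zero (D i₀) (suc n))))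
      where
      not-in : u * a i₀ ∉ expandIII (k , i)
      not-in t∈ = i≢i₀ (Least-unique (proj₂ (expandIII-parts adm t∈)) (Least-later u i₀≥1 D∤u))

  count-toIII-first : ∀ {i₀} u l → toℕ i₀ ≡ 0 → All Admissible l →
    count (u * a i₀) (concatMap expandIII l) ≡ B.count (u , i₀) l
  count-toIII-first {i₀} u l i₀≡0 adm = begin
    count (u * a i₀) (concatMap expandIII l)          ≡⟨ count-concatMap expandIII (u * a i₀) l ⟩
    Σl (λ b → count (u * a i₀) (expandIII b)) l       ≡⟨ Σl-cong l (λ b b∈ → count-expandIII-first u i₀≡0 (All.lookup adm b∈)) ⟩
    Σl (λ b → B.δ b (u , i₀)) l                       ≡⟨ B.Σl-δ (u , i₀) l ⟩
    B.count (u , i₀) l                                ∎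
    where open ≡-Reasoning

  count-toIII-later : ∀ {i₀ u} l → 1 ≤ toℕ i₀ → ¬ D i₀ ∣ u → 1 ≤ u → All Admissible l →
    count (u * a i₀) (concatMap expandIII l) ≡ value (D i₀) (suc n) (λ e → B.count (u * D i₀ ^ e , i₀) l)
  count-toIII-later {i₀} {u} l i₀≥1 D∤u u≥1 adm = begin
    count (u * a i₀) (concatMap expandIII l)
      ≡⟨ count-concatMap expandIII (u * a i₀) l ⟩
    Σl (λ b → count (u * a i₀) (expandIII b)) l
      ≡⟨ Σl-cong l (λ b b∈ → count-expandIII-later b i₀≥1 D∤u u≥1 (All.lookup adm b∈)) ⟩
    Σl (λ b → value (D i₀) (suc n) (λ e → B.δ b (u * D i₀ ^ e , i₀))) l
      ≡⟨ value-Σl (D i₀) (suc n) (λ b e → B.δ b (u * D i₀ ^ e , i₀)) l ⟩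
    value (D i₀) (suc n) (λ e → Σl (λ b → B.δ b (u * D i₀ ^ e , i₀)) l)
      ≡⟨ value-cong (D i₀) (suc n) (λ e → B.Σl-δ (u * D i₀ ^ e , i₀) l) ⟩
    value (D i₀) (suc n) (λ e → B.count (u * D i₀ ^ e , i₀) l) ∎
    where open ≡-Reasoning

  sum-toIII : ∀ l → All Admissible l → sum (concatMap expandIII l) ≡ Σl weight l
  sum-toIII l adm = trans (sum-concatMap expandIII l) (Σl-cong l (λ { (k , i) b∈ → sum-expandIII (All.lookup adm b∈) }))

  toIII-valid : ∀ l → Valid l → IsPartition n (image expandIII l) × CondIII a (image expandIII l)
  toIII-valid l v@(_ , Σ≡n , _) =
    ( sort-sorted (concatMap expandIII l)
    , All.tabulate (λ t∈ → proj₁ (part t∈))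
    , trans (sum-sort (concatMap expandIII l)) (trans (sum-toIII l adm) Σ≡n) )
    , λ t t∈ → let (i , ai∣t , _) = proj₂ (part t∈) in i , ai∣t
    where
    adm = valid⇒admissible v
    part : ∀ {t} → t ∈ image expandIII l → 1 ≤ t × ∃ λ i → Least i t
    part t∈ with ∈-concatMap expandIII l (∈-sort⁻ (concatMap expandIII l) t∈)
    ... | (k , i) , b∈ , t∈b = let (t≥1 , least-i) = expandIII-parts (All.lookup adm b∈) t∈b in t≥1 , i , least-i

  -- for i ≥ 1, the counts of the blocks (u·D_i^e, i) of a valid family are the
  -- base-D_i digits of the multiplicity of u·a_i in its image
  count-later-determined : ∀ {l₁ l₂} → Valid l₁ → Valid l₂ →
    (∀ t → count t (concatMap expandIII l₁) ≡ count t (concatMap expandIII l₂)) →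
    ∀ {k i} → 1 ≤ k → k ≤ n → 1 ≤ toℕ i → B.count (k , i) l₁ ≡ B.count (k , i) l₂
  count-later-determined {l₁} {l₂} v₁@(_ , _ , bounded₁) v₂@(_ , _ , bounded₂) counts≡ {k} {i} k≥1 k≤n i≥1 =
    by-base (2 ≤? D i)
    where
    by-base : Dec (2 ≤ D i) → B.count (k , i) l₁ ≡ B.count (k , i) l₂
    by-base (no D≱2) = trans (below-2 (bounded₁ k i i≥1)) (sym (below-2 (bounded₂ k i i≥1)))
      where
      below-2 : ∀ {c} → c < D i → c ≡ 0
      below-2 {zero}  _   = refl
      below-2 {suc c} c<D = ⊥-elim (D≱2 (<-≤-trans (s≤s (s≤s z≤n)) c<D))
    by-base (yes D≥2) =
      subst (λ k′ → B.count (k′ , i) l₁ ≡ B.count (k′ , i) l₂) u*D^e≡k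
        (value-injective (suc n) (λ e → B.count (u * D i ^ e , i) l₁) (λ e → B.count (u * D i ^ e , i) l₂)
          (λ e → bounded₁ (u * D i ^ e) i i≥1) (λ e → bounded₂ (u * D i ^ e) i i≥1) values≡
          e (exponent-bound D≥2 u≥1 (subst (_≤ n) (sym u*D^e≡k) k≤n)))
      where
      u = proj₁ (factor (D i) k)
      e = proj₂ (factor (D i) k)
      u*D^e≡k = proj₁ (factor-spec D≥2 k≥1)
      D∤u = proj₁ (proj₂ (factor-spec D≥2 k≥1))
      u≥1 = proj₂ (proj₂ (factor-spec D≥2 k≥1))
      values≡ : value (D i) (suc n) (λ e → B.count (u * D i ^ e , i) l₁) ≡ value (D i) (suc n) (λ e → B.count (u * D i ^ e , i) l₂)
      values≡ = trans (sym (count-toIII-later l₁ i≥1 D∤u u≥1 (valid⇒admissible v₁)))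
                  (trans (counts≡ (u * a i)) (count-toIII-later l₂ i≥1 D∤u u≥1 (valid⇒admissible v₂)))

  toIII-injective : ∀ l₁ l₂ → Valid l₁ → Valid l₂ → image expandIII l₁ ≡ image expandIII l₂ → l₁ B.≋ l₂
  toIII-injective l₁ l₂ v₁ v₂ images≡ (k , i) = by-cases (1 ≤? k) (k ≤? n)
    where
    adm₁ = valid⇒admissible v₁
    adm₂ = valid⇒admissible v₂
    counts≡ : ∀ t → count t (concatMap expandIII l₁) ≡ count t (concatMap expandIII l₂)
    counts≡ = image-counts expandIII {l₁} {l₂} images≡
    outside : ¬ (1 ≤ k × k ≤ n) → B.count (k , i) l₁ ≡ B.count (k , i) l₂
    outside out = trans (count-outside adm₁ i out) (sym (count-outside adm₂ i out))
    by-cases : Dec (1 ≤ k) → Dec (k ≤ n) → B.count (k , i) l₁ ≡ B.count (k , i) l₂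
    by-cases (no k≱1)  _         = outside (λ r → k≱1 (proj₁ r))
    by-cases (yes _)   (no k≰n)  = outside (λ r → k≰n (proj₂ r))
    by-cases (yes k≥1) (yes k≤n) with position i
    ... | inj₁ i≡0 = trans (sym (count-toIII-first k l₁ i≡0 adm₁)) (trans (counts≡ (k * a i)) (count-toIII-first k l₂ i≡0 adm₂))
    ... | inj₂ i≥1 = count-later-determined v₁ v₂ counts≡ k≥1 k≤n i≥1

  -- Conversely, a partition satisfying (iii) is the image of the family whose
  -- block (k, i) occurs as often as prescribed by the multiplicity of k·a_i
  -- (i first) or by the e-th base-D_i digit of the multiplicity of u·a_i
  -- (k = u·D_i^e, i ≥ 1).
  module OntoIII (q : List ℕ) (q-part : IsPartition n q) (q-III : CondIII a q) where

    private
      q-sorted = proj₁ q-part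
      q-pos    = proj₁ (proj₂ q-part)
      q-sum    = proj₂ (proj₂ q-part)

    multiplicity : ℕ → Fin m → ℕ → ℕ → ℕ
    multiplicity k i zero    d = count (k * a i) q
    multiplicity k i (suc _) d = digit d (proj₂ (factor d k)) (count (proj₁ (factor d k) * a i) q)

    c : Block → ℕ
    c (k , i) = multiplicity k i (toℕ i) (D i)

    c-first : ∀ k {i} → toℕ i ≡ 0 → c (k , i) ≡ count (k * a i) q
    c-first k i≡0 rewrite i≡0 = refl

    c-later : ∀ k {i} → 1 ≤ toℕ i → c (k , i) ≡ digit (D i) (proj₂ (factor (D i) k)) (count (proj₁ (factor (D i) k) * a i) q)
    c-later k {i} i≥1 with toℕ i | i≥1
    ... | suc _ | _ = refl

    L : List Block
    L = family c

    bounded : ∀ k i → 1 ≤ toℕ i → B.count (k , i) L < D i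
    bounded k i i≥1 with 1 ≤? k | k ≤? n
    ... | yes k≥1 | yes k≤n = subst (_< D i) (sym (trans (count-family-in c i k≥1 k≤n) (c-later k i≥1)))
                                (digit-< _ _ (D-pos a pos i i≥1))
    ... | no  k≱1 | _       = subst (_< D i) (sym (count-family-out c i (λ r → k≱1 (proj₁ r)))) (D-pos a pos i i≥1)
    ... | yes _   | no  k≰n = subst (_< D i) (sym (count-family-out c i (λ r → k≰n (proj₂ r)))) (D-pos a pos i i≥1)

    admissible : All Admissible L
    admissible = All.tabulate λ {b} b∈ →
      let (k≥1 , k≤n) = family-in-range c b∈
      in k≥1 , k≤n , λ i≥1 → <-≤-trans (s≤s (B.∈⇒count>0 b∈)) (bounded (proj₁ b) (proj₂ b) i≥1)

    count-first : ∀ {i₀} u → toℕ i₀ ≡ 0 → 1 ≤ u → count (u * a i₀) (concatMap expandIII L) ≡ count (u * a i₀) q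
    count-first {i₀} u i₀≡0 u≥1 = trans (count-toIII-first u L i₀≡0 admissible) (by-size (u ≤? n))
      where
      by-size : Dec (u ≤ n) → B.count (u , i₀) L ≡ count (u * a i₀) q
      by-size (yes u≤n) = trans (count-family-in c i₀ u≥1 u≤n) (c-first u i₀≡0)
      by-size (no  u≰n) = trans (count-family-out c i₀ (λ r → u≰n (proj₂ r)))
        (sym (count-partition-outside q-part (λ r → u≰n (≤-trans (m≤m*n u (a i₀) {{>-nonZero (pos i₀)}}) (proj₂ r)))))

    count-later : ∀ {i₀} u → 1 ≤ toℕ i₀ → ¬ D i₀ ∣ u → 1 ≤ u → count (u * a i₀) (concatMap expandIII L) ≡ count (u * a i₀) q
    count-later {i₀} u i₀≥1 D∤u u≥1 = begin
      count (u * a i₀) (concatMap expandIII L)           ≡⟨ count-toIII-later L i₀≥1 D∤u u≥1 admissible ⟩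
      value d (suc n) (λ e → B.count (u * d ^ e , i₀) L) ≡⟨ value-cong d (suc n) (λ e → digit-at e (u * d ^ e ≤? n)) ⟩
      value d (suc n) (λ e → digit d e C)                ≡⟨ value-digits (suc n) C (D-pos a pos i₀ i₀≥1) C<d^N ⟩
      C                                                  ∎
      where
      open ≡-Reasoning
      d = D i₀
      C = count (u * a i₀) q
      d≥2 : 2 ≤ d
      d≥2 with d in d↦ | D-pos a pos i₀ i₀≥1
      ... | suc (suc _) | _ = s≤s (s≤s z≤n)
      ... | suc zero    | _ = ⊥-elim (D∤u (divides u (sym (*-identityʳ u))))
      C<d^N : C < d ^ suc n
      C<d^N = <-≤-trans (s≤s (≤-trans (count≤sum (u * a i₀) q q-pos) (≤-reflexive q-sum))) (<⇒≤ (e<d^e (suc n) d≥2))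
      C*u≤n : C * u ≤ n
      C*u≤n = ≤-trans (*-monoʳ-≤ C (m≤m*n u (a i₀) {{>-nonZero (pos i₀)}}))
                      (subst (C * (u * a i₀) ≤_) q-sum (count*≤sum (u * a i₀) q))
      digit-at : ∀ e → Dec (u * d ^ e ≤ n) → B.count (u * d ^ e , i₀) L ≡ digit d e C
      digit-at e (yes le) =
        trans (count-family-in c i₀ (*-mono-≤ u≥1 (m^n>0 d {{>-nonZero (D-pos a pos i₀ i₀≥1)}} e)) le)
              (trans (c-later (u * d ^ e) i₀≥1)
                     (cong (λ ue → digit d (proj₂ ue) (count (proj₁ ue * a i₀) q)) (factor-unique e d≥2 D∤u u≥1)))
      digit-at e (no  nle) = trans (count-family-out c i₀ (λ r → nle (proj₂ r))) (sym (digit-high e C C<d^e))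
        where
        C<d^e : C < d ^ e
        C<d^e = *-cancelʳ-< u C (d ^ e) (<-≤-trans (s≤s C*u≤n) (subst (suc n ≤_) (*-comm u (d ^ e)) (≰⇒> nle)))

    part : ∀ {t} → t ∈ concatMap expandIII L → 1 ≤ t × ∃ λ i → a i ∣ t
    part t∈ with ∈-concatMap expandIII L t∈
    ... | b , b∈ , t∈b = let (t≥1 , i-least) = expandIII-parts (All.lookup admissible b∈) t∈b in t≥1 , _ , proj₁ i-least

    counts : concatMap expandIII L ≋ q
    counts zero = trans (∉⇒count≡0 (λ 0∈ → <-irrefl refl (proj₁ (part 0∈))))
                        (sym (∉⇒count≡0 (λ 0∈ → <-irrefl refl (All.lookup q-pos 0∈))))
    counts t@(suc _) with FP.any? (λ i → a i ∣? t)
    ... | no  none = trans (∉⇒count≡0 (λ t∈ → none (proj₂ (part t∈)))) (sym (∉⇒count≡0 (λ t∈ → none (q-III t t∈))))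
    ... | yes some with least (λ i → a i ∣ t) (λ i → a i ∣? t) some
    ...   | i₀ , divides u t≡u*a , below =
      subst (λ t → count t (concatMap expandIII L) ≡ count t q) (sym t≡u*a) (by-position (position i₀))
      where
      u≥1 : 1 ≤ u
      u≥1 = n≢0⇒n>0 λ { refl → 0≢1+n (sym t≡u*a) }
      least-u : Least i₀ (u * a i₀)
      least-u = n∣m*n u , λ j j<i₀ aj∣ → below j j<i₀ (subst (a j ∣_) (sym t≡u*a) aj∣)
      by-position : toℕ i₀ ≡ 0 ⊎ 1 ≤ toℕ i₀ → count (u * a i₀) (concatMap expandIII L) ≡ count (u * a i₀) q
      by-position (inj₁ i₀≡0) = count-first u i₀≡0 u≥1
      by-position (inj₂ i₀≥1) = count-later u i₀≥1 (Least⇒∤ u i₀≥1 least-u) u≥1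

    image≡q : image expandIII L ≡ q
    image≡q = sort-canonical (concatMap expandIII L) q q-sorted counts

    weight≡n : Σl weight L ≡ n
    weight≡n = trans (sym (sum-toIII L admissible)) (trans (sym (sum-sort (concatMap expandIII L))) (trans (cong sum image≡q) q-sum))

  toIII-onto : ∀ q → IsPartition n q × CondIII a q → ∃ λ l → Valid l × image expandIII l ≡ q
  toIII-onto q (q-part , q-III) = L , (All.tabulate (λ b∈ → proj₁ (family-in-range c b∈)) , weight≡n , bounded) , image≡q
    where open OntoIII q q-part q-III

  bijection-families-III : Bijection Families (Parts n (CondIII a))
  bijection-families-III = bijection-from-families (CondIII a) expandIII toIII-valid toIII-injective toIII-onto

open Bijections using (inverse)
open Conjugation using (bijection-I-II)

theorem2 : ∀ (n m : ℕ) (a : Fin m → ℕ) → 0 < n → (∀ i → 0 < a i) →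
    SameCard (Parts n (CondI a)) (Parts n (CondII a))
    × (CondStar a →
        SameCard (Parts n (CondI a)) (Parts n (CondIII a))
        × SameCard (Parts n (CondII a)) (Parts n (CondIII a)))
theorem2 n m a _ pos = bijection-I-II a n , λ st →
  let open Blocks a pos st n
      II≅III = Composition.bijection (inverse bijection-families-II) bijection-families-III
  in Composition.bijection (bijection-I-II a n) II≅III , II≅III
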